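{- For all $m\geq 0$ and every nonempty partition $\lambda$, $$\beta^{(m+1)}(\lambda)=\sum_{n\ge1}\frac1{n!}\sum_{\substack{(\mu^{(1)},\ldots,\mu^{(n)}):\ \mu^{(1)}\cup\cdots\cup\mu^{(n)}=\lambda\\ \mu^{(i)}\ne\emptyset}}\binom{\lambda}{\mu^{(1)},\ldots,\mu^{(n)}}\prod_{i=1}^{n}\Big(\sum_{d\mid\gcd(\mu^{(i)})}d^{\ell(\mu^{(i)})-1}\beta^{(m)}(\mu^{(i)}/d)\Big),$$ where the inner sum runs over ordered $n$-tuples of nonempty partitions whose multiset union of parts is $\lambda$.
   Context: Let $\Lambda$ be the ring of symmetric functions over $\mathbb{Q}$ in variables $X=(x_1,x_2,\ldots)$, completed with respect to degree. Write $h_n$, $p_\lambda$ for complete homogeneous and power sum symmetric functions. Plethysm: for a formal power series $A$ in the $x_i$ and auxiliary commuting variables (e.g. $t$), $p_k(A)$ is obtained from $A$ by replacing every variable by its $k$-th power, and for $F\in\Lambda$, $F(A)$ is obtained by writing $F$ in terms of the $p_k$ and substituting $p_k\mapsto p_k(A)$ (used only when $A$ has zero constant term, or $F$ is a polynomial). The alphabet $tX$ means $(tx_1,tx_2,\ldots)$. Let $\Omega(X)=\sum_{n\ge0}h_n(X)$, $\Omega_0(X)=\Omega(X)-1$, $\Omega_0^{(0)}(X)=h_1(X)$, $\Omega_0^{(m+1)}(X)=\Omega_0(\Omega_0^{(m)}(X))$, and define $B_n^{(m)}$ by $\Omega(\Omega_0^{(m)}(tX))=\sum_{n\ge0}B_n^{(m)}(X)t^n$.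 For a partition $\lambda$, $m_j(\lambda)$ is the number of parts equal to $j$, $\ell(\lambda)$ the number of parts, $z_\lambda=\prod_{j\ge1}m_j(\lambda)!\,j^{m_j(\lambda)}$, $\gcd(\mu)$ the gcd of the parts of $\mu$, and for $d\mid\gcd(\mu)$, $\mu/d$ is the partition with parts $\mu_i/d$. Define $\beta^{(m)}(\lambda)$ by $B_n^{(m)}=\sum_{\lambda\vdash n}\frac{\beta^{(m)}(\lambda)}{z_\lambda}p_\lambda$. For $\lambda=\mu^{(1)}\cup\cdots\cup\mu^{(n)}$, $\binom{\lambda}{\mu^{(1)},\ldots,\mu^{(n)}}=\prod_{j\ge1}\frac{m_j(\lambda)!}{m_j(\mu^{(1)})!\cdots m_j(\mu^{(n)})!}$. -}

module Defs where

open import Data.Nat as ℕ using (ℕ; zero; suc; _∸_; _≤?_; _<_; _≥_; _!; _^_; _≟_)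
open import Data.Nat.Properties using (≤-decTotalOrder)
open import Data.Nat.Divisibility using (_∣?_)
open import Data.Nat.GCD using (gcd)
open import Data.Integer using (+_)
open import Data.Rational using (ℚ; 0ℚ; 1ℚ; _+_; _*_; _/_)
open import Data.List using (List; []; _∷_; [_]; map; filter; concat; concatMap; foldr; upTo; length; _++_)
open import Data.Nat.ListAction using (sum; product)
open import Data.List.Properties using (≡-dec)
open import Data.List.Relation.Unary.All using (All)
open import Data.List.Relation.Unary.Linked using (Linked)
open import Data.List.Sort.InsertionSort ≤-decTotalOrder using (sort)
open import Data.Product using (_×_; _,_; proj₂)
open import Relation.Nullary.Decidable using (Dec; ⌊_⌋)
open import Relation.Binary.PropositionalEquality using (_≡_)

IsPartition : List ℕ → Set
IsPartition la = All (λ x → 0 < x) la × Linked _≥_ la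

_≈ₘ_ : List ℕ → List ℕ → Set
μ ≈ₘ ν = sort μ ≡ sort ν

_≈ₘ?_ : (μ ν : List ℕ) → Dec (μ ≈ₘ ν)
μ ≈ₘ? ν = ≡-dec _≟_ (sort μ) (sort ν)

range1 : ℕ → List ℕ
range1 n = map suc (upTo n)

mult : ℕ → List ℕ → ℕ
mult j la = length (filter (λ x → x ≟ j) la)

-- z_λ = ∏_j m_j(λ)! j^{m_j(λ)}  (parts are ≤ |λ|)
z : List ℕ → ℕ
z la = product (map (λ j → (mult j la) ! ℕ.* j ^ mult j la) (range1 (sum la)))

-- partitions of n with all parts ≤ b (weakly decreasing lists), with fuel
partitionsB : ℕ → ℕ → ℕ → List (List ℕ)
partitionsB zero    zero    b = [ [] ]
partitionsB zero    (suc n) b = []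
partitionsB (suc f) zero    b = [ [] ]
partitionsB (suc f) (suc n) b =
  concatMap (λ j → map (j ∷_) (partitionsB f (suc n ∸ j) j))
            (filter (λ j → j ≤? b) (range1 (suc n)))

partitions : ℕ → List (List ℕ)
partitions n = partitionsB n n n

ℕtoℚ : ℕ → ℚ
ℕtoℚ n = + n / 1

-- 1/n (only ever applied to nonzero n; 1/0 := 0 convention)
inv : ℕ → ℚ
inv zero    = 0ℚ
inv (suc n) = + 1 / suc n

sumℚ : List ℚ → ℚ
sumℚ = foldr _+_ 0ℚ

prodℚ : List ℚ → ℚ
prodℚ = foldr _*_ 1ℚ

-- Symmetric functions over ℚ in the power-sum basis.
-- Λ_ℚ = ℚ[p_1, p_2, ...]; an element is a finite formal sum of
-- terms c · p_μ, where p_μ = ∏ p_{μ_i} (order of μ irrelevant).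

Sym : Set
Sym = List (List ℕ × ℚ)

scale : ℚ → Sym → Sym
scale c = map (λ { (μ , a) → μ , c * a })

_⊗_ : Sym → Sym → Sym
P ⊗ Q = concatMap (λ { (μ , a) → map (λ { (ν , b) → μ ++ ν , a * b }) Q }) P

oneS : Sym
oneS = [ ([] , 1ℚ) ]

prodS : List Sym → Sym
prodS = foldr _⊗_ oneS

-- plethysm p_k(P): replace every p_j by p_{kj} (rational coefficients fixed)
pk : ℕ → Sym → Sym
pk k = map (λ { (μ , a) → map (k ℕ.*_) μ , a })

-- plethysm F(P), with F written in terms of the p_k
pleth : Sym → Sym → Sym
pleth F P = concatMap (λ { (la , c) → scale c (prodS (map (λ k → pk k P) la)) }) F

trunc : ℕ → Sym → Sym
trunc N = filter (λ { (μ , a) → sum μ ≤? N })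

coeff : List ℕ → Sym → ℚ
coeff la P = sumℚ (map proj₂ (filter (λ { (μ , a) → μ ≈ₘ? la }) P))

h : ℕ → Sym
h k = map (λ la → la , inv (z la)) (partitions k)

ΩUpTo : ℕ → Sym
ΩUpTo N = concatMap h (upTo (suc N))

Ω₀UpTo : ℕ → Sym
Ω₀UpTo N = concatMap h (range1 N)

Ω₀iter : ℕ → ℕ → Sym
Ω₀iter zero    N = h 1
Ω₀iter (suc m) N = trunc N (pleth (Ω₀UpTo N) (Ω₀iter m N))

-- B_n^{(m)} = [t^n] Ω(Ω₀^{(m)}(tX)) = degree-n part of Ω(Ω₀^{(m)}(X));
-- truncation at degree n does not affect the degree-n part.
B : ℕ → ℕ → Sym
B m n = pleth (ΩUpTo n) (Ω₀iter m n)

β : ℕ → List ℕ → ℚ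
β m la = ℕtoℚ (z la) * coeff la (B m (sum la))

tuples : ℕ → ℕ → List (List (List ℕ))
tuples zero    zero    = [ [] ]
tuples zero    (suc N) = []
tuples (suc n) N =
  concatMap (λ a → concatMap (λ μ → map (μ ∷_) (tuples n (N ∸ a))) (partitions a))
            (range1 N)

covers : ℕ → List ℕ → List (List (List ℕ))
covers n la = filter (λ μs → concat μs ≈ₘ? la) (tuples n (sum la))

multinom : List ℕ → List (List ℕ) → ℚ
multinom la μs =
  prodℚ (map (λ j → ℕtoℚ ((mult j la) !) * inv (product (map (λ μ → (mult j μ) !) μs)))
             (range1 (sum la)))

gcdL : List ℕ → ℕ
gcdL = foldr gcd 0

divP : List ℕ → (d : ℕ) → .{{_ : ℕ.NonZero d}} → List ℕ
divP μ d = map (λ x → x ℕ./ d) μ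

innerSum : ℕ → List ℕ → ℚ
innerSum m μ =
  sumℚ (map (λ k → if ⌊ suc k ∣? gcdL μ ⌋
                   then ℕtoℚ (suc k ^ (length μ ∸ 1)) * β m (divP μ (suc k))
                   else 0ℚ)
            (upTo (gcdL μ)))
  where open import Data.Bool using (if_then_else_)

{-# OPTIONS --safe #-}
-- Write L = Σₖ pₖ/k, so that Ω = exp L, i.e. hₙ = Σ_{λ⊢n} p_λ/z_λ is the degree-n part of
-- Σₙ Lⁿ/n!.  Plethysm by a series F without constant term is a ring homomorphism, so
-- Ω(F) = Σₙ (L(F))ⁿ/n! for F = Ω₀^{(m+1)}, and the coefficient of p_λ in an n-th power is a
-- sum over ordered n-tuples (μ¹,…,μⁿ) with union λ of products of coefficients of L(F).
-- Since pₖ(F) only has terms p_{kν}, z_μ·[p_μ] L(F) = Σ_{d ∣ gcd μ} (z_μ/d)·[p_{μ/d}] F, and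
-- [p_ν] Ω₀(G) = [p_ν] Ω(G) = β^{(m)}(ν)/z_ν for G = Ω₀^{(m)} and ν ≠ ∅, while
-- z_μ = d^{ℓ(μ)} z_{μ/d}: this is the inner divisor sum.  Finally the multinomial coefficient
-- converts ∏ᵢ z_{μ⁽ⁱ⁾} into z_λ.  All series are truncated; coefficients of partitions of size
-- at most |λ| do not depend on the truncation degree, as long as it is at least |λ|.
module Submission where

open import Defs
open import Algebra.Bundles using (CommutativeMonoid)
import Algebra.Properties.CommutativeSemigroup as CommSemigroupProperties
open import Data.Bool using (if_then_else_; true; false)
open import Data.Empty using (⊥-elim)
open import Data.List using (List; []; _∷_; [_]; _++_; map; concat; concatMap; filter; applyUpTo; upTo; replicate; length)
import Data.List.Properties as ListP
open import Data.List.Relation.Unary.All as All using (All; []; _∷_; all?)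
import Data.List.Relation.Unary.All.Properties as AllP
open import Data.List.Relation.Binary.Permutation.Propositional as ↭ using (_↭_; ↭-sym; ↭-trans; ↭-reflexive)
import Data.List.Relation.Binary.Permutation.Propositional.Properties as ↭P
open import Data.Nat as ℕ using (ℕ; zero; suc; _∸_; _^_; _!; _≤_; _<_; _≥_; _≟_; _≤?_; _<?_; z≤n; s≤s)
import Data.Nat.Properties as ℕP
open import Data.Nat.ListAction using (sum; product)
open import Data.Nat.ListAction.Properties using (sum-↭; sum-++; product-↭; product-++)
open import Data.Product using (_×_; _,_; proj₁; proj₂)
open import Data.Rational using (ℚ; 0ℚ; 1ℚ; _+_; _*_)
import Data.Rational.Properties as ℚP
open import Function using (_∘_; id)
open import Relation.Nullary using (Dec; yes; no; ¬_; does)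
open import Relation.Nullary.Decidable using (_×-dec_; ⌊_⌋)
open import Relation.Binary.PropositionalEquality using (_≡_; _≢_; refl; sym; trans; cong; cong₂; subst)
open Relation.Binary.PropositionalEquality.≡-Reasoning

module ℚ+ = CommSemigroupProperties (CommutativeMonoid.commutativeSemigroup ℚP.+-0-commutativeMonoid)
module ℚ* = CommSemigroupProperties (CommutativeMonoid.commutativeSemigroup ℚP.*-1-commutativeMonoid)
module ℕ* = CommSemigroupProperties ℕP.*-commutativeSemigroup

module ℚ-Solver where

  open import Data.Maybe.Base using (nothing)
  open import Tactic.RingSolver.Core.AlmostCommutativeRing using (fromCommutativeRing)
  open import Tactic.RingSolver.NonReflective (fromCommutativeRing ℚP.+-*-commutativeRing (λ _ → nothing)) public
    using (solve; _⊜_) renaming (_⊗_ to _⊗ₑ_)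

module Casts where

  open import Data.Integer as ℤ using (+_)
  import Data.Integer.Properties as ℤP
  open import Data.Rational using (toℚᵘ)
  open import Data.Rational.Properties using (toℚᵘ-injective; toℚᵘ-fromℚᵘ; toℚᵘ-homo-+; toℚᵘ-homo-*)
  import Data.Rational.Unnormalised as U
  import Data.Rational.Unnormalised.Properties as UP

  private
    toℚᵘ-ℕtoℚ : ∀ n → toℚᵘ (ℕtoℚ n) U.≃ U.mkℚᵘ (+ n) 0
    toℚᵘ-ℕtoℚ n = toℚᵘ-fromℚᵘ (U.mkℚᵘ (+ n) 0)

    toℚᵘ-inv : ∀ n → toℚᵘ (inv (suc n)) U.≃ U.mkℚᵘ (+ 1) n
    toℚᵘ-inv n = toℚᵘ-fromℚᵘ (U.mkℚᵘ (+ 1) n)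

  ℕtoℚ-+ : ∀ a b → ℕtoℚ (a ℕ.+ b) ≡ ℕtoℚ a + ℕtoℚ b
  ℕtoℚ-+ a b = toℚᵘ-injective (UP.≃-trans (toℚᵘ-ℕtoℚ (a ℕ.+ b)) (UP.≃-trans
    (U.*≡* (cong (ℤ._* + 1) (trans (ℤP.pos-+ a b) (sym (cong₂ ℤ._+_ (ℤP.*-identityʳ (+ a)) (ℤP.*-identityʳ (+ b)))))))
    (UP.≃-sym (UP.≃-trans (toℚᵘ-homo-+ (ℕtoℚ a) (ℕtoℚ b)) (UP.+-cong (toℚᵘ-ℕtoℚ a) (toℚᵘ-ℕtoℚ b))))))

  ℕtoℚ-* : ∀ a b → ℕtoℚ (a ℕ.* b) ≡ ℕtoℚ a * ℕtoℚ b
  ℕtoℚ-* a b = toℚᵘ-injective (UP.≃-trans (toℚᵘ-ℕtoℚ (a ℕ.* b)) (UP.≃-trans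
    (U.*≡* (cong (ℤ._* + 1) (ℤP.pos-* a b)))
    (UP.≃-sym (UP.≃-trans (toℚᵘ-homo-* (ℕtoℚ a) (ℕtoℚ b)) (UP.*-cong (toℚᵘ-ℕtoℚ a) (toℚᵘ-ℕtoℚ b))))))

  inv-* : ∀ a b → inv (a ℕ.* b) ≡ inv a * inv b
  inv-* zero b = sym (ℚP.*-zeroˡ (inv b))
  inv-* (suc a) zero = trans (cong inv (ℕP.*-zeroʳ (suc a))) (sym (ℚP.*-zeroʳ (inv (suc a))))
  inv-* (suc a) (suc b) = toℚᵘ-injective (UP.≃-trans (toℚᵘ-inv (b ℕ.+ a ℕ.* suc b))
    (UP.≃-trans (U.*≡* refl)
      (UP.≃-sym (UP.≃-trans (toℚᵘ-homo-* (inv (suc a)) (inv (suc b))) (UP.*-cong (toℚᵘ-inv a) (toℚᵘ-inv b))))))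

  inv*ℕtoℚ≡1 : ∀ {n} → 0 < n → inv n * ℕtoℚ n ≡ 1ℚ
  inv*ℕtoℚ≡1 {suc n} _ = toℚᵘ-injective (UP.≃-trans (toℚᵘ-homo-* (inv (suc n)) (ℕtoℚ (suc n)))
    (UP.≃-trans (UP.*-cong (toℚᵘ-inv n) (toℚᵘ-ℕtoℚ (suc n)))
      (U.*≡* (trans (ℤP.*-identityʳ (+ 1 ℤ.* + suc n)) (trans (ℤP.*-identityˡ (+ suc n))
        (sym (trans (ℤP.*-identityˡ (+ (suc n ℕ.* 1))) (cong +_ (ℕP.*-identityʳ (suc n))))))))))

  ℕtoℚ-product : ∀ {A : Set} (f : A → ℕ) xs → prodℚ (map (ℕtoℚ ∘ f) xs) ≡ ℕtoℚ (product (map f xs))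
  ℕtoℚ-product f [] = refl
  ℕtoℚ-product f (x ∷ xs) = trans (cong (ℕtoℚ (f x) *_) (ℕtoℚ-product f xs)) (sym (ℕtoℚ-* (f x) _))

  inv-product : ∀ {A : Set} (f : A → ℕ) xs → prodℚ (map (inv ∘ f) xs) ≡ inv (product (map f xs))
  inv-product f [] = refl
  inv-product f (x ∷ xs) = trans (cong (inv (f x) *_) (inv-product f xs)) (sym (inv-* (f x) _))

  prodℚ-map-inv : ∀ ν → prodℚ (map inv ν) ≡ inv (product ν)
  prodℚ-map-inv ν = trans (inv-product id ν) (cong (inv ∘ product) (ListP.map-id ν))

  *ℕtoℚ≡⇒≡*inv : ∀ a b {g} → 0 < g → a * ℕtoℚ g ≡ b → a ≡ b * inv g
  *ℕtoℚ≡⇒≡*inv a b {g} g>0 e = begin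
    a                       ≡⟨ ℚP.*-identityʳ a ⟨
    a * 1ℚ                  ≡⟨ cong (a *_) (trans (ℚP.*-comm (ℕtoℚ g) (inv g)) (inv*ℕtoℚ≡1 g>0)) ⟨
    a * (ℕtoℚ g * inv g)    ≡⟨ ℚP.*-assoc a (ℕtoℚ g) (inv g) ⟨
    (a * ℕtoℚ g) * inv g    ≡⟨ cong (_* inv g) e ⟩
    b * inv g               ∎

module FiniteSums where

  Σ : ∀ {a} {A : Set a} → List A → (A → ℚ) → ℚ
  Σ xs f = sumℚ (map f xs)

  𝟙 : ∀ {p} {P : Set p} → Dec P → ℚ
  𝟙 d = if does d then 1ℚ else 0ℚ

  module _ {a} {A : Set a} where

    Σ-++ : (xs ys : List A) (f : A → ℚ) → Σ (xs ++ ys) f ≡ Σ xs f + Σ ys f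
    Σ-++ [] ys f = sym (ℚP.+-identityˡ _)
    Σ-++ (x ∷ xs) ys f = trans (cong (f x +_) (Σ-++ xs ys f)) (sym (ℚP.+-assoc (f x) _ _))

    Σ-cong : (xs : List A) {f g : A → ℚ} → (∀ x → f x ≡ g x) → Σ xs f ≡ Σ xs g
    Σ-cong [] e = refl
    Σ-cong (x ∷ xs) e = cong₂ _+_ (e x) (Σ-cong xs e)

    Σ-cong-All : {xs : List A} {f g : A → ℚ} → All (λ x → f x ≡ g x) xs → Σ xs f ≡ Σ xs g
    Σ-cong-All [] = refl
    Σ-cong-All (e ∷ es) = cong₂ _+_ e (Σ-cong-All es)

    Σ-zero : {xs : List A} {f : A → ℚ} → All (λ x → f x ≡ 0ℚ) xs → Σ xs f ≡ 0ℚ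
    Σ-zero [] = refl
    Σ-zero (e ∷ es) = trans (cong₂ _+_ e (Σ-zero es)) (ℚP.+-identityˡ 0ℚ)

    Σ-zero-∀ : (xs : List A) {f : A → ℚ} → (∀ x → f x ≡ 0ℚ) → Σ xs f ≡ 0ℚ
    Σ-zero-∀ xs e = Σ-zero (All.universal e xs)

    Σ-distrib-+ : (xs : List A) (f g : A → ℚ) → Σ xs (λ x → f x + g x) ≡ Σ xs f + Σ xs g
    Σ-distrib-+ [] f g = refl
    Σ-distrib-+ (x ∷ xs) f g =
      trans (cong ((f x + g x) +_) (Σ-distrib-+ xs f g)) (ℚ+.interchange (f x) (g x) (Σ xs f) (Σ xs g))

    *-distribˡ-Σ : (c : ℚ) (xs : List A) (f : A → ℚ) → c * Σ xs f ≡ Σ xs (λ x → c * f x)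
    *-distribˡ-Σ c [] f = ℚP.*-zeroʳ c
    *-distribˡ-Σ c (x ∷ xs) f = trans (ℚP.*-distribˡ-+ c (f x) _) (cong (c * f x +_) (*-distribˡ-Σ c xs f))

    *-distribʳ-Σ : (c : ℚ) (xs : List A) (f : A → ℚ) → Σ xs f * c ≡ Σ xs (λ x → f x * c)
    *-distribʳ-Σ c xs f = trans (ℚP.*-comm _ c) (trans (*-distribˡ-Σ c xs f) (Σ-cong xs (λ x → ℚP.*-comm c (f x))))

    Σ-filter : ∀ {p} {P : A → Set p} (P? : ∀ x → Dec (P x)) (xs : List A) (f : A → ℚ) →
               Σ (filter P? xs) f ≡ Σ xs (λ x → 𝟙 (P? x) * f x)
    Σ-filter P? [] f = refl
    Σ-filter P? (x ∷ xs) f with P? x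
    ... | yes _ = cong₂ _+_ (sym (ℚP.*-identityˡ (f x))) (Σ-filter P? xs f)
    ... | no _ = trans (Σ-filter P? xs f) (trans (sym (ℚP.+-identityˡ _)) (cong (_+ _) (sym (ℚP.*-zeroˡ (f x)))))

  module _ {a b} {A : Set a} {B : Set b} where

    Σ-map : (g : A → B) (xs : List A) (f : B → ℚ) → Σ (map g xs) f ≡ Σ xs (f ∘ g)
    Σ-map g [] f = refl
    Σ-map g (x ∷ xs) f = cong (f (g x) +_) (Σ-map g xs f)

    Σ-concatMap : (g : A → List B) (xs : List A) (f : B → ℚ) →
                  Σ (concatMap g xs) f ≡ Σ xs (λ x → Σ (g x) f)
    Σ-concatMap g [] f = refl
    Σ-concatMap g (x ∷ xs) f = trans (Σ-++ (g x) (concatMap g xs) f) (cong (Σ (g x) f +_) (Σ-concatMap g xs f))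

    Σ-comm : (xs : List A) (ys : List B) (f : A → B → ℚ) →
             Σ xs (λ x → Σ ys (f x)) ≡ Σ ys (λ y → Σ xs (λ x → f x y))
    Σ-comm [] ys f = sym (Σ-zero-∀ ys (λ _ → refl))
    Σ-comm (x ∷ xs) ys f = trans (cong (Σ ys (f x) +_) (Σ-comm xs ys f))
                                 (sym (Σ-distrib-+ ys (f x) (λ y → Σ xs (λ x → f x y))))

  module _ {p} {P : Set p} where

    𝟙-yes : (d : Dec P) → P → 𝟙 d ≡ 1ℚ
    𝟙-yes (yes _) _ = refl
    𝟙-yes (no ¬p) p = ⊥-elim (¬p p)

    𝟙-no : (d : Dec P) → ¬ P → 𝟙 d ≡ 0ℚ
    𝟙-no (yes p) ¬p = ⊥-elim (¬p p)
    𝟙-no (no _) _ = refl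

    𝟙-yes-* : (d : Dec P) {x : ℚ} → P → 𝟙 d * x ≡ x
    𝟙-yes-* d {x} p = trans (cong (_* x) (𝟙-yes d p)) (ℚP.*-identityˡ x)

    𝟙-no-* : (d : Dec P) {x : ℚ} → ¬ P → 𝟙 d * x ≡ 0ℚ
    𝟙-no-* d {x} ¬p = trans (cong (_* x) (𝟙-no d ¬p)) (ℚP.*-zeroˡ x)

    𝟙-guard : (d : Dec P) {u v : ℚ} → (P → u ≡ v) → 𝟙 d * u ≡ 𝟙 d * v
    𝟙-guard (yes p) e = cong (1ℚ *_) (e p)
    𝟙-guard (no _) {u} {v} e = trans (ℚP.*-zeroˡ u) (sym (ℚP.*-zeroˡ v))

    if-then-0≡𝟙* : (d : Dec P) (x : ℚ) → (if ⌊ d ⌋ then x else 0ℚ) ≡ 𝟙 d * x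
    if-then-0≡𝟙* (yes _) x = sym (ℚP.*-identityˡ x)
    if-then-0≡𝟙* (no _) x = sym (ℚP.*-zeroˡ x)

  𝟙-⇔ : ∀ {p q} {P : Set p} {Q : Set q} (d : Dec P) (e : Dec Q) → (P → Q) → (Q → P) → 𝟙 d ≡ 𝟙 e
  𝟙-⇔ (yes p) e f g = sym (𝟙-yes e (f p))
  𝟙-⇔ (no ¬p) e f g = sym (𝟙-no e (λ q → ¬p (g q)))

  𝟙-× : ∀ {p q} {P : Set p} {Q : Set q} (d : Dec P) (e : Dec Q) → 𝟙 (d ×-dec e) ≡ 𝟙 d * 𝟙 e
  𝟙-× (yes _) (yes _) = refl
  𝟙-× (yes _) (no _) = refl
  𝟙-× (no _) (yes _) = refl
  𝟙-× (no _) (no _) = refl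

  Σ-δ-absent : ∀ (xs : List ℕ) x (g : ℕ → ℚ) → All (_≢ x) xs → Σ xs (λ j → 𝟙 (j ≟ x) * g j) ≡ 0ℚ
  Σ-δ-absent xs x g ne = Σ-zero (All.map (𝟙-no-* (_ ≟ x)) ne)

module Intervals where

  open FiniteSums

  interval : ℕ → ℕ → List ℕ
  interval a zero = []
  interval a (suc M) = a ∷ interval (suc a) M

  interval-suc : ∀ a M → interval (suc a) M ≡ map suc (interval a M)
  interval-suc a zero = refl
  interval-suc a (suc M) = cong (suc a ∷_) (interval-suc (suc a) M)

  applyUpTo≡map-interval : ∀ {A : Set} (f : ℕ → A) M → applyUpTo f M ≡ map f (interval 0 M)
  applyUpTo≡map-interval f zero = refl
  applyUpTo≡map-interval f (suc M) = cong (f 0 ∷_) (begin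
    applyUpTo (f ∘ suc) M           ≡⟨ applyUpTo≡map-interval (f ∘ suc) M ⟩
    map (f ∘ suc) (interval 0 M)     ≡⟨ ListP.map-∘ (interval 0 M) ⟩
    map f (map suc (interval 0 M))   ≡⟨ cong (map f) (interval-suc 0 M) ⟨
    map f (interval 1 M)             ∎)

  upTo≡interval : ∀ M → upTo M ≡ interval 0 M
  upTo≡interval M = trans (applyUpTo≡map-interval id M) (ListP.map-id (interval 0 M))

  range1≡interval : ∀ M → range1 M ≡ interval 1 M
  range1≡interval M = trans (cong (map suc) (upTo≡interval M)) (sym (interval-suc 0 M))

  upTo-suc : ∀ N → upTo (suc N) ≡ 0 ∷ range1 N
  upTo-suc N = trans (upTo≡interval (suc N)) (cong (0 ∷_) (sym (range1≡interval N)))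

  interval-lower : ∀ a M → All (a ≤_) (interval a M)
  interval-lower a zero = []
  interval-lower a (suc M) = ℕP.≤-refl ∷ All.map (ℕP.≤-trans (ℕP.n≤1+n a)) (interval-lower (suc a) M)

  interval-upper : ∀ a M → All (_< a ℕ.+ M) (interval a M)
  interval-upper a zero = []
  interval-upper a (suc M) rewrite ℕP.+-suc a M =
    s≤s (ℕP.m≤m+n a M) ∷ interval-upper (suc a) M

  interval-split : ∀ a g M → g ≤ M → interval a M ≡ interval a g ++ interval (a ℕ.+ g) (M ∸ g)
  interval-split a zero M _ = cong (λ b → interval b M) (sym (ℕP.+-identityʳ a))
  interval-split a (suc g) (suc M) (s≤s g≤M) rewrite ℕP.+-suc a g = cong (a ∷_) (interval-split (suc a) g M g≤M)

  range1-bounds : ∀ M → All (λ j → 1 ≤ j × j ≤ M) (range1 M)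
  range1-bounds M rewrite range1≡interval M =
    All.zipWith (λ { (p , s≤s q) → p , q }) (interval-lower 1 M , interval-upper 1 M)

  Σ-interval-δ : ∀ a M x (g : ℕ → ℚ) → a ≤ x → x < a ℕ.+ M → Σ (interval a M) (λ j → 𝟙 (j ≟ x) * g j) ≡ g x
  Σ-interval-δ a zero x g a≤x x<a = ⊥-elim (ℕP.<-irrefl refl (ℕP.<-≤-trans (subst (x <_) (ℕP.+-identityʳ a) x<a) a≤x))
  Σ-interval-δ a (suc M) x g a≤x x<a+M with a ≟ x
  ... | yes refl = begin
    𝟙 (a ≟ a) * g a + Σ (interval (suc a) M) (λ j → 𝟙 (j ≟ a) * g j)
      ≡⟨ cong₂ _+_ (𝟙-yes-* (a ≟ a) refl) (Σ-δ-absent (interval (suc a) M) a g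
                     (All.map (λ a<j j≡a → ℕP.<-irrefl (sym j≡a) a<j) (interval-lower (suc a) M))) ⟩
    g a + 0ℚ ≡⟨ ℚP.+-identityʳ (g a) ⟩
    g a ∎
  ... | no a≢x = begin
    𝟙 (a ≟ x) * g a + Σ (interval (suc a) M) (λ j → 𝟙 (j ≟ x) * g j)
      ≡⟨ cong₂ _+_ (𝟙-no-* (a ≟ x) a≢x)
                   (Σ-interval-δ (suc a) M x g (ℕP.≤∧≢⇒< a≤x a≢x) (subst (x <_) (ℕP.+-suc a M) x<a+M)) ⟩
    0ℚ + g x ≡⟨ ℚP.+-identityˡ (g x) ⟩
    g x ∎

  Σ-interval-δ-outside : ∀ a M x (g : ℕ → ℚ) → ¬ (a ≤ x × x < a ℕ.+ M) → Σ (interval a M) (λ j → 𝟙 (j ≟ x) * g j) ≡ 0ℚ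
  Σ-interval-δ-outside a M x g out = Σ-δ-absent (interval a M) x g
    (All.zipWith (λ { (p , q) refl → out (p , q) }) (interval-lower a M , interval-upper a M))

  Σ-interval-single : ∀ a M x (F : ℕ → ℚ) → a ≤ x → x < a ℕ.+ M → (∀ b → b ≢ x → F b ≡ 0ℚ) → Σ (interval a M) F ≡ F x
  Σ-interval-single a M x F a≤x x<a+M others = trans (Σ-cong (interval a M) only-δ) (Σ-interval-δ a M x F a≤x x<a+M)
    where
    only-δ : ∀ b → F b ≡ 𝟙 (b ≟ x) * F b
    only-δ b with b ≟ x
    ... | yes b≡x = sym (𝟙-yes-* (b ≟ x) b≡x)
    ... | no b≢x = trans (others b b≢x) (sym (𝟙-no-* (b ≟ x) b≢x))

  Σ-upTo-extend : ∀ g N (F : ℕ → ℚ) → g ≤ N → (∀ k → g ≤ k → F k ≡ 0ℚ) → Σ (upTo g) F ≡ Σ (upTo N) F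
  Σ-upTo-extend g N F g≤N F-vanishes = begin
    Σ (upTo g) F                                    ≡⟨ cong (λ l → Σ l F) (upTo≡interval g) ⟩
    Σ (interval 0 g) F                              ≡⟨ ℚP.+-identityʳ _ ⟨
    Σ (interval 0 g) F + 0ℚ                         ≡⟨ cong (Σ (interval 0 g) F +_) (Σ-zero (All.map (F-vanishes _) (interval-lower g (N ∸ g)))) ⟨
    Σ (interval 0 g) F + Σ (interval g (N ∸ g)) F   ≡⟨ Σ-++ (interval 0 g) (interval g (N ∸ g)) F ⟨
    Σ (interval 0 g ++ interval g (N ∸ g)) F        ≡⟨ cong (λ l → Σ l F) (interval-split 0 g N g≤N) ⟨
    Σ (interval 0 N) F                              ≡⟨ cong (λ l → Σ l F) (upTo≡interval N) ⟨
    Σ (upTo N) F                                    ∎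

module Multisets where

  open import Data.List.Relation.Binary.Pointwise using (Pointwise-≡⇒≡)
  open import Data.List.Relation.Unary.Linked using (Linked)
  import Data.List.Sort.InsertionSort.Base as InsertionSort
  import Data.List.Sort.InsertionSort.Properties as InsertionSortP
  import Data.List.Relation.Unary.Sorted.TotalOrder.Properties as SortedP
  import Relation.Binary.Properties.DecTotalOrder as DecTotalOrderP
  import Relation.Binary.Properties.TotalOrder as TotalOrderP
  import Relation.Binary.PropositionalEquality as ≡

  private
    module Asc = InsertionSortP ℕP.≤-decTotalOrder
    module Desc = InsertionSortP (DecTotalOrderP.≥-decTotalOrder ℕP.≤-decTotalOrder)

  toPartition : List ℕ → List ℕ
  toPartition = InsertionSort.sort (DecTotalOrderP.≥-decTotalOrder ℕP.≤-decTotalOrder)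

  toPartition-↭ : ∀ xs → toPartition xs ↭ xs
  toPartition-↭ = Desc.sort-↭

  ≈ₘ⇒↭ : ∀ {μ ν} → μ ≈ₘ ν → μ ↭ ν
  ≈ₘ⇒↭ {μ} {ν} e = ↭-trans (↭-sym (Asc.sort-↭ μ)) (subst (_↭ ν) (sym e) (Asc.sort-↭ ν))

  ↭⇒≈ₘ : ∀ {μ ν} → μ ↭ ν → μ ≈ₘ ν
  ↭⇒≈ₘ {μ} {ν} p = Pointwise-≡⇒≡ (SortedP.↗↭↗⇒≋ ℕP.≤-totalOrder (Asc.sort-↗ μ) (Asc.sort-↗ ν)
    (↭.↭⇒↭ₛ′ ≡.isEquivalence (↭-trans (Asc.sort-↭ μ) (↭-trans p (↭-sym (Asc.sort-↭ ν))))))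

  decreasing-↭-unique : ∀ {μ ν} → Linked _≥_ μ → Linked _≥_ ν → μ ↭ ν → μ ≡ ν
  decreasing-↭-unique μ≥ ν≥ p = Pointwise-≡⇒≡
    (SortedP.↗↭↗⇒≋ (TotalOrderP.≥-totalOrder ℕP.≤-totalOrder) μ≥ ν≥ (↭.↭⇒↭ₛ′ ≡.isEquivalence p))

  toPartition-isPartition : ∀ {xs} → All (0 <_) xs → IsPartition (toPartition xs)
  toPartition-isPartition {xs} pos = ↭P.All-resp-↭ (↭-sym (toPartition-↭ xs)) pos , Desc.sort-↗ xs

  partition≡toPartition : ∀ {ρ ν} → IsPartition ρ → ρ ↭ ν → ρ ≡ toPartition ν
  partition≡toPartition {ρ} {ν} (_ , ρ≥) p =
    decreasing-↭-unique ρ≥ (Desc.sort-↗ ν) (↭-trans p (↭-sym (toPartition-↭ ν)))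

  ≈ₘ-sum : ∀ {μ ν} → μ ≈ₘ ν → sum μ ≡ sum ν
  ≈ₘ-sum {μ} {ν} e = sum-↭ (≈ₘ⇒↭ {μ} {ν} e)

module PartitionEnumeration where

  open FiniteSums
  open Intervals
  open Multisets
  open import Data.List.Properties using (≡-dec; ∷-injective)
  open import Data.List.Relation.Unary.Linked as Linked using (Linked; []; [-]; _∷_)

  private
    infix 4 _≟ₗ_
    _≟ₗ_ : (ρ τ : List ℕ) → Dec (ρ ≡ τ)
    _≟ₗ_ = ≡-dec _≟_

    ≥-∷ : ∀ {j ρ} → All (_≤ j) ρ → Linked _≥_ ρ → Linked _≥_ (j ∷ ρ)
    ≥-∷ {ρ = []} _ _ = [-]
    ≥-∷ {ρ = _ ∷ _} (p ∷ _) l = p ∷ l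

    ≥-head : ∀ {x τ} → Linked _≥_ (x ∷ τ) → All (_≤ x) τ
    ≥-head [-] = []
    ≥-head (p ∷ l) = p ∷ All.map (λ q → ℕP.≤-trans q p) (≥-head l)

    part≤sum : ∀ ν → All (_≤ sum ν) ν
    part≤sum [] = []
    part≤sum (x ∷ ν) = ℕP.m≤m+n x (sum ν) ∷ All.map (λ q → ℕP.≤-trans q (ℕP.m≤n+m (sum ν) x)) (part≤sum ν)

  All-concatMap : ∀ {A B : Set} {P : B → Set} (g : A → List B) {xs : List A} →
                  All (λ x → All P (g x)) xs → All P (concatMap g xs)
  All-concatMap g ps = AllP.concat⁺ (AllP.map⁺ ps)

  All-filter : ∀ {A : Set} {P Q : A → Set} (Q? : ∀ x → Dec (Q x)) {xs : List A} →
               All (λ x → Q x → P x) xs → All P (filter Q? xs)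
  All-filter Q? {xs} ps = All.zipWith (λ { (f , q) → f q }) (AllP.filter⁺ Q? ps , AllP.all-filter Q? xs)

  partitionsB-valid : ∀ f n b → All (λ ρ → IsPartition ρ × All (_≤ b) ρ) (partitionsB f n b)
  partitionsB-valid zero zero b = (([] , []) , []) ∷ []
  partitionsB-valid zero (suc n) b = []
  partitionsB-valid (suc f) zero b = (([] , []) , []) ∷ []
  partitionsB-valid (suc f) (suc n) b = All-concatMap _ (All-filter (_≤? b) (All.map extend (range1-bounds (suc n))))
    where
    extend : ∀ {j} → 1 ≤ j × j ≤ suc n → j ≤ b → All (λ ρ → IsPartition ρ × All (_≤ b) ρ) (map (j ∷_) (partitionsB f (suc n ∸ j) j))
    extend (j>0 , _) j≤b = AllP.map⁺ (All.map (λ { ((pos , ρ≥) , ρ≤j) →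
      ((j>0 ∷ pos) , ≥-∷ ρ≤j ρ≥) , (j≤b ∷ All.map (λ q → ℕP.≤-trans q j≤b) ρ≤j) }) (partitionsB-valid f _ _))

  partitionsB-sum : ∀ f n b → n ≤ f → All (λ ρ → sum ρ ≡ n) (partitionsB f n b)
  partitionsB-sum zero zero b _ = refl ∷ []
  partitionsB-sum (suc f) zero b _ = refl ∷ []
  partitionsB-sum (suc f) (suc n) b (s≤s n≤f) = All-concatMap _ (All-filter (_≤? b) (All.map extend (range1-bounds (suc n))))
    where
    extend : ∀ {j} → 1 ≤ j × j ≤ suc n → j ≤ b → All (λ ρ → sum ρ ≡ suc n) (map (j ∷_) (partitionsB f (suc n ∸ j) j))
    extend {j} (j>0 , j≤) _ = AllP.map⁺ (All.map (λ e → trans (cong (j ℕ.+_) e) (ℕP.m+[n∸m]≡n j≤))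
      (partitionsB-sum f (suc n ∸ j) j (ℕP.≤-trans (ℕP.∸-monoʳ-≤ (suc n) j>0) n≤f)))

  partitions-isPartition : ∀ n → All IsPartition (partitions n)
  partitions-isPartition n = All.map proj₁ (partitionsB-valid n n n)

  partitions-sum : ∀ n → All (λ ρ → sum ρ ≡ n) (partitions n)
  partitions-sum n = partitionsB-sum n n n ℕP.≤-refl

  Σ-partitionsB-suc : ∀ f n b (F : List ℕ → ℚ) → Σ (partitionsB (suc f) (suc n) b) F ≡
    Σ (interval 1 (suc n)) (λ j → 𝟙 (j ≤? b) * Σ (partitionsB f (suc n ∸ j) j) (F ∘ (j ∷_)))
  Σ-partitionsB-suc f n b F = begin
    Σ (concatMap (λ j → map (j ∷_) (P j)) (filter (_≤? b) (range1 (suc n)))) F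
      ≡⟨ Σ-concatMap (λ j → map (j ∷_) (P j)) (filter (_≤? b) (range1 (suc n))) F ⟩
    Σ (filter (_≤? b) (range1 (suc n))) (λ j → Σ (map (j ∷_) (P j)) F)
      ≡⟨ Σ-filter (_≤? b) (range1 (suc n)) _ ⟩
    Σ (range1 (suc n)) (λ j → 𝟙 (j ≤? b) * Σ (map (j ∷_) (P j)) F)
      ≡⟨ Σ-cong (range1 (suc n)) (λ j → cong (𝟙 (j ≤? b) *_) (Σ-map (j ∷_) (P j) F)) ⟩
    Σ (range1 (suc n)) (λ j → 𝟙 (j ≤? b) * Σ (P j) (F ∘ (j ∷_)))
      ≡⟨ cong (λ l → Σ l (λ j → 𝟙 (j ≤? b) * Σ (P j) (F ∘ (j ∷_)))) (range1≡interval (suc n)) ⟩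
    Σ (interval 1 (suc n)) (λ j → 𝟙 (j ≤? b) * Σ (P j) (F ∘ (j ∷_))) ∎
    where
    P : ℕ → List (List ℕ)
    P j = partitionsB f (suc n ∸ j) j

  private
    𝟙-∷ : ∀ j ρ x τ → 𝟙 (j ∷ ρ ≟ₗ x ∷ τ) ≡ 𝟙 (j ≟ x) * 𝟙 (ρ ≟ₗ τ)
    𝟙-∷ j ρ x τ = trans (𝟙-⇔ (j ∷ ρ ≟ₗ x ∷ τ) ((j ≟ x) ×-dec (ρ ≟ₗ τ)) ∷-injective (λ { (refl , refl) → refl })) (𝟙-× (j ≟ x) (ρ ≟ₗ τ))

    count-[] : ∀ b τ → IsPartition τ →
               Σ ([] ∷ []) (λ ρ → 𝟙 (ρ ≟ₗ τ)) ≡ 𝟙 ((sum τ ≟ 0) ×-dec (all? (_≤? b) τ))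
    count-[] b [] _ = refl
    count-[] b (x ∷ τ) ((x>0 ∷ _) , _) = trans (ℚP.+-identityʳ _) (trans (𝟙-no ([] ≟ₗ (x ∷ τ)) (λ ()))
      (sym (𝟙-no ((x ℕ.+ sum τ ≟ 0) ×-dec (all? (_≤? b) (x ∷ τ))) (λ { (e , _) → ℕP.<-irrefl (sym e) (ℕP.<-≤-trans x>0 (ℕP.m≤m+n x (sum τ))) }))))

  partitionsB-count : ∀ f n b → n ≤ f → ∀ τ → IsPartition τ →
                      Σ (partitionsB f n b) (λ ρ → 𝟙 (ρ ≟ₗ τ)) ≡ 𝟙 ((sum τ ≟ n) ×-dec (all? (_≤? b) τ))
  partitionsB-count zero zero b _ τ τ-part = count-[] b τ τ-part
  partitionsB-count (suc f) zero b _ τ τ-part = count-[] b τ τ-part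
  partitionsB-count (suc f) (suc n) b (s≤s n≤f) [] _ = trans (Σ-partitionsB-suc f n b _)
    (trans (Σ-zero-∀ (interval 1 (suc n)) (λ j → trans (cong (𝟙 (j ≤? b) *_)
             (Σ-zero-∀ (partitionsB f (suc n ∸ j) j) (λ ρ → 𝟙-no (j ∷ ρ ≟ₗ []) (λ ())))) (ℚP.*-zeroʳ (𝟙 (j ≤? b)))))
           (sym (𝟙-no ((0 ≟ suc n) ×-dec (all? (_≤? b) [])) (λ { (() , _) }))))
  partitionsB-count (suc f) (suc n) b (s≤s n≤f) (x ∷ τ) ((x>0 ∷ pos) , x∷τ≥) = begin
    Σ (partitionsB (suc f) (suc n) b) (λ ρ → 𝟙 (ρ ≟ₗ x ∷ τ))
      ≡⟨ Σ-partitionsB-suc f n b _ ⟩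
    Σ (interval 1 (suc n)) (λ j → 𝟙 (j ≤? b) * Σ (P j) (λ ρ → 𝟙 (j ∷ ρ ≟ₗ x ∷ τ)))
      ≡⟨ Σ-cong (interval 1 (suc n)) split-head ⟩
    Σ (interval 1 (suc n)) (λ j → 𝟙 (j ≟ x) * (𝟙 (j ≤? b) * count j))
      ≡⟨ select-head (x ℕ.≤? suc n) ⟩
    𝟙 ((x ℕ.+ sum τ ≟ suc n) ×-dec (all? (_≤? b) (x ∷ τ))) ∎
    where
    P : ℕ → List (List ℕ)
    P j = partitionsB f (suc n ∸ j) j
    count : ℕ → ℚ
    count j = Σ (P j) (λ ρ → 𝟙 (ρ ≟ₗ τ))
    split-head : ∀ j → 𝟙 (j ≤? b) * Σ (P j) (λ ρ → 𝟙 (j ∷ ρ ≟ₗ x ∷ τ)) ≡ 𝟙 (j ≟ x) * (𝟙 (j ≤? b) * count j)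
    split-head j = begin
      𝟙 (j ≤? b) * Σ (P j) (λ ρ → 𝟙 (j ∷ ρ ≟ₗ x ∷ τ))
        ≡⟨ cong (𝟙 (j ≤? b) *_) (trans (Σ-cong (P j) (λ ρ → 𝟙-∷ j ρ x τ)) (sym (*-distribˡ-Σ (𝟙 (j ≟ x)) (P j) _))) ⟩
      𝟙 (j ≤? b) * (𝟙 (j ≟ x) * count j)
        ≡⟨ ℚ*.x∙yz≈y∙xz (𝟙 (j ≤? b)) (𝟙 (j ≟ x)) (count j) ⟩
      𝟙 (j ≟ x) * (𝟙 (j ≤? b) * count j) ∎
    select-head : Dec (x ≤ suc n) → Σ (interval 1 (suc n)) (λ j → 𝟙 (j ≟ x) * (𝟙 (j ≤? b) * count j)) ≡
                                    𝟙 ((x ℕ.+ sum τ ≟ suc n) ×-dec (all? (_≤? b) (x ∷ τ)))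
    select-head (yes x≤) = begin
      Σ (interval 1 (suc n)) (λ j → 𝟙 (j ≟ x) * (𝟙 (j ≤? b) * count j))
        ≡⟨ Σ-interval-δ 1 (suc n) x (λ j → 𝟙 (j ≤? b) * count j) x>0 (s≤s x≤) ⟩
      𝟙 (x ≤? b) * count x
        ≡⟨ cong (𝟙 (x ≤? b) *_) (partitionsB-count f (suc n ∸ x) x (ℕP.≤-trans (ℕP.∸-monoʳ-≤ (suc n) x>0) n≤f) τ (pos , Linked.tail x∷τ≥)) ⟩
      𝟙 (x ≤? b) * 𝟙 ((sum τ ≟ suc n ∸ x) ×-dec (all? (_≤? x) τ))
        ≡⟨ 𝟙-× (x ≤? b) ((sum τ ≟ suc n ∸ x) ×-dec (all? (_≤? x) τ)) ⟨
      𝟙 ((x ≤? b) ×-dec ((sum τ ≟ suc n ∸ x) ×-dec (all? (_≤? x) τ)))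
        ≡⟨ 𝟙-⇔ ((x ≤? b) ×-dec ((sum τ ≟ suc n ∸ x) ×-dec (all? (_≤? x) τ))) ((x ℕ.+ sum τ ≟ suc n) ×-dec (all? (_≤? b) (x ∷ τ)))
              (λ { (x≤b , e , τ≤x) → trans (cong (x ℕ.+_) e) (ℕP.m+[n∸m]≡n x≤) , (x≤b ∷ All.map (λ q → ℕP.≤-trans q x≤b) τ≤x) })
              (λ { (e , (x≤b ∷ _)) → x≤b , trans (sym (ℕP.m+n∸m≡n x (sum τ))) (cong (_∸ x) e) , ≥-head x∷τ≥ }) ⟩
      𝟙 ((x ℕ.+ sum τ ≟ suc n) ×-dec (all? (_≤? b) (x ∷ τ))) ∎
    select-head (no x≰) = trans (Σ-interval-δ-outside 1 (suc n) x _ (λ { (_ , s≤s x≤) → x≰ x≤ }))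
      (sym (𝟙-no ((x ℕ.+ sum τ ≟ suc n) ×-dec (all? (_≤? b) (x ∷ τ))) (λ { (e , _) → x≰ (ℕP.≤-trans (ℕP.m≤m+n x (sum τ)) (ℕP.≤-reflexive e)) })))

  Respects↭ : (List ℕ → ℚ) → Set
  Respects↭ φ = ∀ {a b} → All (0 <_) b → a ↭ b → φ a ≡ φ b

  Σ-partitions-δ : ∀ j ν → All (0 <_) ν → (φ : List ℕ → ℚ) → Respects↭ φ →
                   Σ (partitions j) (λ ρ → 𝟙 (ν ≈ₘ? ρ) * φ ρ) ≡ 𝟙 (sum ν ≟ j) * φ ν
  Σ-partitions-δ j ν pos φ φ-resp = begin
    Σ (partitions j) (λ ρ → 𝟙 (ν ≈ₘ? ρ) * φ ρ)
      ≡⟨ Σ-cong-All (All.map (λ {ρ} ρ-part → trans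
            (cong (_* φ ρ) (𝟙-⇔ (ν ≈ₘ? ρ) (ρ ≟ₗ τ)
               (λ e → partition≡toPartition ρ-part (↭-sym (≈ₘ⇒↭ {ν} {ρ} e)))
               (λ { refl → ↭⇒≈ₘ (↭-sym (toPartition-↭ ν)) })))
            (𝟙-guard (ρ ≟ₗ τ) (cong φ))) (partitions-isPartition j)) ⟩
    Σ (partitions j) (λ ρ → 𝟙 (ρ ≟ₗ τ) * φ τ)
      ≡⟨ *-distribʳ-Σ (φ τ) (partitions j) _ ⟨
    Σ (partitions j) (λ ρ → 𝟙 (ρ ≟ₗ τ)) * φ τ
      ≡⟨ cong₂ _*_ (partitionsB-count j j j ℕP.≤-refl τ (toPartition-isPartition pos)) (φ-resp pos (toPartition-↭ ν)) ⟩
    𝟙 ((sum τ ≟ j) ×-dec (all? (_≤? j) τ)) * φ ν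
      ≡⟨ cong (_* φ ν) (𝟙-⇔ ((sum τ ≟ j) ×-dec (all? (_≤? j) τ)) (sum ν ≟ j)
            (λ { (e , _) → trans (sym τ-sum) e })
            (λ { refl → τ-sum , subst (λ s → All (_≤ s) τ) τ-sum (part≤sum τ) })) ⟩
    𝟙 (sum ν ≟ j) * φ ν ∎
    where
    τ = toPartition ν
    τ-sum : sum τ ≡ sum ν
    τ-sum = sum-↭ (toPartition-↭ ν)

  partitionsUpTo : ℕ → List (List ℕ)
  partitionsUpTo K = concatMap partitions (upTo (suc K))

  partitionsUpTo-isPartition : ∀ K → All IsPartition (partitionsUpTo K)
  partitionsUpTo-isPartition K = All-concatMap partitions (All.universal partitions-isPartition (upTo (suc K)))

  partitionsUpTo-sum≤ : ∀ K → All (λ ρ → sum ρ ≤ K) (partitionsUpTo K)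
  partitionsUpTo-sum≤ K = All-concatMap partitions (subst (All (λ j → All (λ ρ → sum ρ ≤ K) (partitions j))) (sym (upTo≡interval (suc K)))
    (All.map (λ { {j} (s≤s j≤K) → All.map (λ e → ℕP.≤-trans (ℕP.≤-reflexive e) j≤K) (partitions-sum j) }) (interval-upper 0 (suc K))))

  Σ-partitionsUpTo-δ : ∀ K ν → All (0 <_) ν → (φ : List ℕ → ℚ) → Respects↭ φ →
                       Σ (partitionsUpTo K) (λ ρ → 𝟙 (ν ≈ₘ? ρ) * φ ρ) ≡ 𝟙 (sum ν ≤? K) * φ ν
  Σ-partitionsUpTo-δ K ν pos φ φ-resp = begin
    Σ (partitionsUpTo K) (λ ρ → 𝟙 (ν ≈ₘ? ρ) * φ ρ)
      ≡⟨ Σ-concatMap partitions (upTo (suc K)) (λ ρ → 𝟙 (ν ≈ₘ? ρ) * φ ρ) ⟩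
    Σ (upTo (suc K)) (λ j → Σ (partitions j) (λ ρ → 𝟙 (ν ≈ₘ? ρ) * φ ρ))
      ≡⟨ Σ-cong (upTo (suc K)) (λ j → trans (Σ-partitions-δ j ν pos φ φ-resp) (cong (_* φ ν) (𝟙-⇔ (sum ν ≟ j) (j ≟ sum ν) sym sym))) ⟩
    Σ (upTo (suc K)) (λ j → 𝟙 (j ≟ sum ν) * φ ν)
      ≡⟨ cong (λ l → Σ l (λ j → 𝟙 (j ≟ sum ν) * φ ν)) (upTo≡interval (suc K)) ⟩
    Σ (interval 0 (suc K)) (λ j → 𝟙 (j ≟ sum ν) * φ ν)
      ≡⟨ select (sum ν ≤? K) ⟩
    𝟙 (sum ν ≤? K) * φ ν ∎
    where
    select : (d : Dec (sum ν ≤ K)) → Σ (interval 0 (suc K)) (λ j → 𝟙 (j ≟ sum ν) * φ ν) ≡ 𝟙 d * φ ν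
    select d@(yes ν≤K) = trans (Σ-interval-δ 0 (suc K) (sum ν) (λ _ → φ ν) z≤n (s≤s ν≤K)) (sym (𝟙-yes-* d {φ ν} ν≤K))
    select d@(no ν≰K) = trans (Σ-interval-δ-outside 0 (suc K) (sum ν) (λ _ → φ ν) (λ { (_ , s≤s ν≤K) → ν≰K ν≤K })) (sym (𝟙-no-* d {φ ν} ν≰K))

module CentralizerOrder where

  open Intervals
  open import Data.List.Relation.Unary.Any using (here; there)
  open import Data.List.Membership.Propositional using (_∉_)

  Π : {A : Set} → List A → (A → ℕ) → ℕ
  Π xs f = product (map f xs)

  Π-cong-All : {A : Set} {xs : List A} {f g : A → ℕ} → All (λ x → f x ≡ g x) xs → Π xs f ≡ Π xs g
  Π-cong-All [] = refl
  Π-cong-All (e ∷ es) = cong₂ ℕ._*_ e (Π-cong-All es)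

  Π-distrib-* : {A : Set} (xs : List A) (f g : A → ℕ) → Π xs (λ x → f x ℕ.* g x) ≡ Π xs f ℕ.* Π xs g
  Π-distrib-* [] f g = refl
  Π-distrib-* (x ∷ xs) f g = trans (cong (f x ℕ.* g x ℕ.*_) (Π-distrib-* xs f g)) (ℕ*.interchange (f x) (g x) (Π xs f) (Π xs g))

  Π-const-1 : {A : Set} (xs : List A) {f : A → ℕ} → (∀ x → f x ≡ 1) → Π xs f ≡ 1
  Π-const-1 [] e = refl
  Π-const-1 (x ∷ xs) e = cong₂ ℕ._*_ (e x) (Π-const-1 xs e)

  Π-comm : {A B : Set} (xs : List A) (ys : List B) (f : A → B → ℕ) → Π xs (λ x → Π ys (f x)) ≡ Π ys (λ y → Π xs (λ x → f x y))
  Π-comm [] ys f = sym (Π-const-1 ys (λ _ → refl))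
  Π-comm (x ∷ xs) ys f = trans (cong (Π ys (f x) ℕ.*_) (Π-comm xs ys f)) (sym (Π-distrib-* ys (f x) (λ y → Π xs (λ x → f x y))))

  Π-positive : ∀ {A : Set} (xs : List A) (f : A → ℕ) → (∀ x → 0 < f x) → 0 < Π xs f
  Π-positive [] f f>0 = s≤s z≤n
  Π-positive (x ∷ xs) f f>0 = ℕP.*-mono-≤ (f>0 x) (Π-positive xs f f>0)

  Π-interval-update : ∀ a M x (f g : ℕ → ℕ) c → a ≤ x → x < a ℕ.+ M → (∀ j → j ≢ x → g j ≡ f j) → g x ≡ c ℕ.* f x →
                      Π (interval a M) g ≡ c ℕ.* Π (interval a M) f
  Π-interval-update a zero x f g c a≤x x<a _ _ =
    ⊥-elim (ℕP.<-irrefl refl (ℕP.<-≤-trans (subst (x <_) (ℕP.+-identityʳ a) x<a) a≤x))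
  Π-interval-update a (suc M) x f g c a≤x x<a+M same at-x with a ≟ x
  ... | yes refl = trans (cong₂ ℕ._*_ at-x (Π-cong-All (All.map (λ {j} a<j → same j (λ j≡a → ℕP.<-irrefl (sym j≡a) a<j)) (interval-lower (suc a) M))))
                         (ℕP.*-assoc c (f a) _)
  ... | no a≢x = trans (cong₂ ℕ._*_ (same a a≢x)
                         (Π-interval-update (suc a) M x f g c (ℕP.≤∧≢⇒< a≤x a≢x) (subst (x <_) (ℕP.+-suc a M) x<a+M) same at-x))
                       (ℕ*.x∙yz≈y∙xz (f a) c (Π (interval (suc a) M) f))

  mult-∷-≡ : ∀ x ν → mult x (x ∷ ν) ≡ suc (mult x ν)
  mult-∷-≡ x ν with x ℕ.≡ᵇ x | ℕP.≡⇒≡ᵇ x x refl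
  ... | true | _ = refl
  ... | false | ()

  mult-∷-≢ : ∀ x y ν → y ≢ x → mult x (y ∷ ν) ≡ mult x ν
  mult-∷-≢ x y ν y≢x with y ℕ.≡ᵇ x | ℕP.≡ᵇ⇒≡ y x
  ... | true | y≡x = ⊥-elim (y≢x (y≡x _))
  ... | false | _ = refl

  mult-∉ : ∀ x ν → x ∉ ν → mult x ν ≡ 0
  mult-∉ x [] _ = refl
  mult-∉ x (y ∷ ν) x∉ = trans (mult-∷-≢ x y ν (λ y≡x → x∉ (here (sym y≡x)))) (mult-∉ x ν (x∉ ∘ there))

  mult-↭ : ∀ j {a b} → a ↭ b → mult j a ≡ mult j b
  mult-↭ j p = ↭P.↭-length (↭P.filter-↭ (_≟ j) p)

  z-↭ : ∀ {a b} → a ↭ b → z a ≡ z b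
  z-↭ {a} {b} p = trans (cong (λ s → Π (range1 s) (λ j → mult j a ! ℕ.* j ^ mult j a)) (sum-↭ p))
    (cong product (ListP.map-cong (λ j → cong₂ (λ u v → u ! ℕ.* j ^ v) (mult-↭ j p) (mult-↭ j p)) (range1 (sum b))))

  -- equals ∏ⱼ mⱼ(ν)!
  multFactorials : List ℕ → ℕ
  multFactorials [] = 1
  multFactorials (x ∷ ν) = suc (mult x ν) ℕ.* multFactorials ν

  multFactorials-↭ : ∀ {a b} → a ↭ b → multFactorials a ≡ multFactorials b
  multFactorials-↭ ↭.refl = refl
  multFactorials-↭ (↭.prep x p) = cong₂ ℕ._*_ (cong suc (mult-↭ x p)) (multFactorials-↭ p)
  multFactorials-↭ (↭.swap {xs = xs} {ys = ys} x y p) with x ≟ y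
  ... | yes refl = begin
    suc (mult x (x ∷ xs)) ℕ.* (suc (mult x xs) ℕ.* multFactorials xs)
      ≡⟨ cong (λ u → suc u ℕ.* (suc (mult x xs) ℕ.* multFactorials xs)) (mult-∷-≡ x xs) ⟩
    suc (suc (mult x xs)) ℕ.* (suc (mult x xs) ℕ.* multFactorials xs)
      ≡⟨ cong₂ (λ u t → suc (suc u) ℕ.* (suc u ℕ.* t)) (mult-↭ x p) (multFactorials-↭ p) ⟩
    suc (suc (mult x ys)) ℕ.* (suc (mult x ys) ℕ.* multFactorials ys)
      ≡⟨ cong (λ u → suc u ℕ.* (suc (mult x ys) ℕ.* multFactorials ys)) (mult-∷-≡ x ys) ⟨
    suc (mult x (x ∷ ys)) ℕ.* (suc (mult x ys) ℕ.* multFactorials ys) ∎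
  ... | no x≢y = begin
    suc (mult x (y ∷ xs)) ℕ.* (suc (mult y xs) ℕ.* multFactorials xs)
      ≡⟨ cong (λ u → suc u ℕ.* (suc (mult y xs) ℕ.* multFactorials xs)) (mult-∷-≢ x y xs (x≢y ∘ sym)) ⟩
    suc (mult x xs) ℕ.* (suc (mult y xs) ℕ.* multFactorials xs)
      ≡⟨ cong₂ (λ u v → suc u ℕ.* (suc v ℕ.* multFactorials xs)) (mult-↭ x p) (mult-↭ y p) ⟩
    suc (mult x ys) ℕ.* (suc (mult y ys) ℕ.* multFactorials xs)
      ≡⟨ cong (λ t → suc (mult x ys) ℕ.* (suc (mult y ys) ℕ.* t)) (multFactorials-↭ p) ⟩
    suc (mult x ys) ℕ.* (suc (mult y ys) ℕ.* multFactorials ys)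
      ≡⟨ ℕ*.x∙yz≈y∙xz (suc (mult x ys)) (suc (mult y ys)) (multFactorials ys) ⟩
    suc (mult y ys) ℕ.* (suc (mult x ys) ℕ.* multFactorials ys)
      ≡⟨ cong (λ u → suc u ℕ.* (suc (mult x ys) ℕ.* multFactorials ys)) (mult-∷-≢ y x ys x≢y) ⟨
    suc (mult y (x ∷ ys)) ℕ.* (suc (mult x ys) ℕ.* multFactorials ys) ∎
  multFactorials-↭ (↭.trans p q) = trans (multFactorials-↭ p) (multFactorials-↭ q)

  multFactorials-positive : ∀ ν → 0 < multFactorials ν
  multFactorials-positive [] = s≤s z≤n
  multFactorials-positive (x ∷ ν) = ℕP.*-mono-≤ {1} {suc (mult x ν)} (s≤s z≤n) (multFactorials-positive ν)

  PartsIn : ℕ → List ℕ → Set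
  PartsIn M ν = All (λ x → 1 ≤ x × x ≤ M) ν

  partsIn-sum : ∀ ν → All (0 <_) ν → PartsIn (sum ν) ν
  partsIn-sum [] [] = []
  partsIn-sum (x ∷ ν) (x>0 ∷ pos) = (x>0 , ℕP.m≤m+n x (sum ν))
    ∷ All.map (λ { (p , q) → p , ℕP.≤-trans q (ℕP.m≤n+m (sum ν) x) }) (partsIn-sum ν pos)

  partsIn-≤ : ∀ {M} ν → All (0 <_) ν → sum ν ≤ M → PartsIn M ν
  partsIn-≤ ν pos le = All.map (λ { (p , q) → p , ℕP.≤-trans q le }) (partsIn-sum ν pos)

  Π-mult!≡multFactorials : ∀ M ν → PartsIn M ν → Π (interval 1 M) (λ j → mult j ν !) ≡ multFactorials ν
  Π-mult!≡multFactorials M [] [] = Π-const-1 (interval 1 M) (λ _ → refl)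
  Π-mult!≡multFactorials M (x ∷ ν) ((p , q) ∷ r) = trans
    (Π-interval-update 1 M x (λ j → mult j ν !) (λ j → mult j (x ∷ ν) !) (suc (mult x ν)) p (s≤s q)
       (λ j j≢x → cong _! (mult-∷-≢ j x ν (j≢x ∘ sym))) (cong _! (mult-∷-≡ x ν)))
    (cong (suc (mult x ν) ℕ.*_) (Π-mult!≡multFactorials M ν r))

  Π-pow-mult≡product : ∀ M ν → PartsIn M ν → Π (interval 1 M) (λ j → j ^ mult j ν) ≡ product ν
  Π-pow-mult≡product M [] [] = Π-const-1 (interval 1 M) (λ _ → refl)
  Π-pow-mult≡product M (x ∷ ν) ((p , q) ∷ r) = trans
    (Π-interval-update 1 M x (λ j → j ^ mult j ν) (λ j → j ^ mult j (x ∷ ν)) x p (s≤s q)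
       (λ j j≢x → cong (j ^_) (mult-∷-≢ j x ν (j≢x ∘ sym))) (cong (x ^_) (mult-∷-≡ x ν)))
    (cong (x ℕ.*_) (Π-pow-mult≡product M ν r))

  z≡multFactorials*product : ∀ ν → All (0 <_) ν → z ν ≡ multFactorials ν ℕ.* product ν
  z≡multFactorials*product ν pos = begin
    Π (range1 (sum ν)) (λ j → mult j ν ! ℕ.* j ^ mult j ν)
      ≡⟨ cong (λ l → Π l (λ j → mult j ν ! ℕ.* j ^ mult j ν)) (range1≡interval (sum ν)) ⟩
    Π (interval 1 (sum ν)) (λ j → mult j ν ! ℕ.* j ^ mult j ν)
      ≡⟨ Π-distrib-* (interval 1 (sum ν)) _ _ ⟩
    Π (interval 1 (sum ν)) (λ j → mult j ν !) ℕ.* Π (interval 1 (sum ν)) (λ j → j ^ mult j ν)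
      ≡⟨ cong₂ ℕ._*_ (Π-mult!≡multFactorials (sum ν) ν (partsIn-sum ν pos)) (Π-pow-mult≡product (sum ν) ν (partsIn-sum ν pos)) ⟩
    multFactorials ν ℕ.* product ν ∎

  product-positive : ∀ ν → All (0 <_) ν → 0 < product ν
  product-positive [] [] = s≤s z≤n
  product-positive (x ∷ ν) (x>0 ∷ pos) = ℕP.*-mono-≤ x>0 (product-positive ν pos)

  z-positive : ∀ ν → All (0 <_) ν → 0 < z ν
  z-positive ν pos = subst (0 <_) (sym (z≡multFactorials*product ν pos))
    (ℕP.*-mono-≤ (multFactorials-positive ν) (product-positive ν pos))

  module _ (k-1 : ℕ) where

    private
      k = suc k-1

    mult-map-* : ∀ x ν → mult (k ℕ.* x) (map (k ℕ.*_) ν) ≡ mult x ν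
    mult-map-* x [] = refl
    mult-map-* x (y ∷ ν) with y ≟ x
    ... | yes refl = trans (mult-∷-≡ (k ℕ.* y) (map (k ℕ.*_) ν)) (trans (cong suc (mult-map-* y ν)) (sym (mult-∷-≡ y ν)))
    ... | no y≢x = trans (mult-∷-≢ (k ℕ.* x) (k ℕ.* y) (map (k ℕ.*_) ν) (y≢x ∘ ℕP.*-cancelˡ-≡ y x k))
                         (trans (mult-map-* x ν) (sym (mult-∷-≢ x y ν y≢x)))

    multFactorials-map-* : ∀ ν → multFactorials (map (k ℕ.*_) ν) ≡ multFactorials ν
    multFactorials-map-* [] = refl
    multFactorials-map-* (x ∷ ν) = cong₂ (λ u v → suc u ℕ.* v) (mult-map-* x ν) (multFactorials-map-* ν)

    product-map-* : ∀ ν → product (map (k ℕ.*_) ν) ≡ k ^ length ν ℕ.* product ν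
    product-map-* [] = refl
    product-map-* (x ∷ ν) = trans (cong (k ℕ.* x ℕ.*_) (product-map-* ν)) (ℕ*.interchange k x (k ^ length ν) (product ν))

    positive-map-* : ∀ ν → All (0 <_) ν → All (0 <_) (map (k ℕ.*_) ν)
    positive-map-* [] [] = []
    positive-map-* (x ∷ ν) (x>0 ∷ pos) = ℕP.*-mono-≤ {1} {k} (s≤s z≤n) x>0 ∷ positive-map-* ν pos

    z-map-* : ∀ ν → All (0 <_) ν → z (map (k ℕ.*_) ν) ≡ k ^ length ν ℕ.* z ν
    z-map-* ν pos = begin
      z (map (k ℕ.*_) ν)
        ≡⟨ z≡multFactorials*product (map (k ℕ.*_) ν) (positive-map-* ν pos) ⟩
      multFactorials (map (k ℕ.*_) ν) ℕ.* product (map (k ℕ.*_) ν)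
        ≡⟨ cong₂ ℕ._*_ (multFactorials-map-* ν) (product-map-* ν) ⟩
      multFactorials ν ℕ.* (k ^ length ν ℕ.* product ν)
        ≡⟨ ℕ*.x∙yz≈y∙xz (multFactorials ν) (k ^ length ν) (product ν) ⟩
      k ^ length ν ℕ.* (multFactorials ν ℕ.* product ν)
        ≡⟨ cong (k ^ length ν ℕ.*_) (z≡multFactorials*product ν pos) ⟨
      k ^ length ν ℕ.* z ν ∎

module Coefficients where

  open FiniteSums
  open Multisets
  open PartitionEnumeration
  open CentralizerOrder using (z-↭)
  open import Data.Nat.Divisibility using (_∣_; _∣?_; m∣m*n)
  open import Data.Nat.DivMod using (m*n/n≡m; m*[n/m]≡n)

  pν : List ℕ → Sym → Sym
  pν ν A = prodS (map (λ k → pk k A) ν)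

  Positive : Sym → Set
  Positive P = All (λ t → All (0 <_) (proj₁ t)) P

  MinDegree : ℕ → Sym → Set
  MinDegree d P = All (λ t → d ≤ sum (proj₁ t)) P

  coeff-Σ : ∀ la P → coeff la P ≡ Σ P (λ t → 𝟙 (proj₁ t ≈ₘ? la) * proj₂ t)
  coeff-Σ la P = trans (Σ-filter (λ { (μ , a) → μ ≈ₘ? la }) P proj₂) (Σ-cong P (λ { (μ , a) → refl }))

  𝟙≈ₘ-respˡ : ∀ {μ μ'} la → μ ↭ μ' → 𝟙 (μ ≈ₘ? la) ≡ 𝟙 (μ' ≈ₘ? la)
  𝟙≈ₘ-respˡ {μ} {μ'} la p = 𝟙-⇔ (μ ≈ₘ? la) (μ' ≈ₘ? la) (trans (↭⇒≈ₘ (↭-sym p))) (trans (↭⇒≈ₘ p))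

  𝟙≈ₘ-larger : ∀ μ la → sum la < sum μ → 𝟙 (μ ≈ₘ? la) ≡ 0ℚ
  𝟙≈ₘ-larger μ la lt = 𝟙-no (μ ≈ₘ? la) (λ e → ℕP.<-irrefl (sym (≈ₘ-sum {μ} {la} e)) lt)

  coeff-below-MinDegree : ∀ d P la → MinDegree d P → sum la < d → coeff la P ≡ 0ℚ
  coeff-below-MinDegree d P la P≥d la<d = trans (coeff-Σ la P) (Σ-zero (All.map (λ {t} d≤t →
    trans (cong (_* proj₂ t) (𝟙≈ₘ-larger (proj₁ t) la (ℕP.<-≤-trans la<d d≤t))) (ℚP.*-zeroˡ (proj₂ t))) P≥d))

  Σ-terms≡Σ-coeff : ∀ K (X : Sym) → Positive X → (φ : List ℕ → ℚ) → Respects↭ φ → (∀ μ → K < sum μ → φ μ ≡ 0ℚ) →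
                    Σ X (λ s → proj₂ s * φ (proj₁ s)) ≡ Σ (partitionsUpTo K) (λ ρ → coeff ρ X * φ ρ)
  Σ-terms≡Σ-coeff K X X-pos φ φ-resp φ-vanishes = sym (begin
    Σ (partitionsUpTo K) (λ ρ → coeff ρ X * φ ρ)
      ≡⟨ Σ-cong (partitionsUpTo K) (λ ρ → trans (cong (_* φ ρ) (coeff-Σ ρ X)) (*-distribʳ-Σ (φ ρ) X _)) ⟩
    Σ (partitionsUpTo K) (λ ρ → Σ X (λ s → (𝟙 (proj₁ s ≈ₘ? ρ) * proj₂ s) * φ ρ))
      ≡⟨ Σ-comm (partitionsUpTo K) X (λ ρ s → (𝟙 (proj₁ s ≈ₘ? ρ) * proj₂ s) * φ ρ) ⟩
    Σ X (λ s → Σ (partitionsUpTo K) (λ ρ → (𝟙 (proj₁ s ≈ₘ? ρ) * proj₂ s) * φ ρ))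
      ≡⟨ Σ-cong X (λ s → trans (Σ-cong (partitionsUpTo K) (λ ρ → ℚ*.xy∙z≈y∙xz (𝟙 (proj₁ s ≈ₘ? ρ)) (proj₂ s) (φ ρ)))
                               (sym (*-distribˡ-Σ (proj₂ s) (partitionsUpTo K) _))) ⟩
    Σ X (λ s → proj₂ s * Σ (partitionsUpTo K) (λ ρ → 𝟙 (proj₁ s ≈ₘ? ρ) * φ ρ))
      ≡⟨ Σ-cong-All (All.map (λ {s} s-pos → cong (proj₂ s *_)
            (trans (Σ-partitionsUpTo-δ K (proj₁ s) s-pos φ φ-resp) (drop-guard (proj₁ s)))) X-pos) ⟩
    Σ X (λ s → proj₂ s * φ (proj₁ s)) ∎)
    where
    drop-guard : ∀ μ → 𝟙 (sum μ ≤? K) * φ μ ≡ φ μ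
    drop-guard μ with sum μ ≤? K
    ... | yes μ≤K = 𝟙-yes-* (sum μ ≤? K) μ≤K
    ... | no μ≰K = trans (𝟙-no-* (sum μ ≤? K) μ≰K) (sym (φ-vanishes μ (ℕP.≰⇒> μ≰K)))

  Σ-⊗ : ∀ P Q (F : List ℕ × ℚ → ℚ) → Σ (P ⊗ Q) F ≡ Σ P (λ t → Σ Q (λ s → F (proj₁ t ++ proj₁ s , proj₂ t * proj₂ s)))
  Σ-⊗ [] Q F = refl
  Σ-⊗ ((μ , a) ∷ P) Q F = trans (Σ-++ (map _ Q) (P ⊗ Q) F) (cong₂ _+_ (Σ-map _ Q F) (Σ-⊗ P Q F))

  Σ-scale : ∀ c P (F : List ℕ × ℚ → ℚ) → Σ (scale c P) F ≡ Σ P (λ t → F (proj₁ t , c * proj₂ t))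
  Σ-scale c [] F = refl
  Σ-scale c ((μ , a) ∷ P) F = cong (F (μ , c * a) +_) (Σ-scale c P F)

  Σ-pk : ∀ k P (F : List ℕ × ℚ → ℚ) → Σ (pk k P) F ≡ Σ P (λ t → F (map (k ℕ.*_) (proj₁ t) , proj₂ t))
  Σ-pk k [] F = refl
  Σ-pk k ((μ , a) ∷ P) F = cong (F (map (k ℕ.*_) μ , a) +_) (Σ-pk k P F)

  Σ-pleth : ∀ X A (F : List ℕ × ℚ → ℚ) → Σ (pleth X A) F ≡ Σ X (λ t → Σ (scale (proj₂ t) (pν (proj₁ t) A)) F)
  Σ-pleth [] A F = refl
  Σ-pleth ((μ , a) ∷ X) A F = trans (Σ-++ (scale a (pν μ A)) (pleth X A) F) (cong (Σ (scale a (pν μ A)) F +_) (Σ-pleth X A F))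

  coeff-⊗-terms : ∀ la P Q → coeff la (P ⊗ Q) ≡ Σ P (λ t → Σ Q (λ s → 𝟙 ((proj₁ t ++ proj₁ s) ≈ₘ? la) * (proj₂ t * proj₂ s)))
  coeff-⊗-terms la P Q = trans (coeff-Σ la (P ⊗ Q)) (Σ-⊗ P Q (λ t → 𝟙 (proj₁ t ≈ₘ? la) * proj₂ t))

  private
    𝟙++-respʳ : ∀ μ la → Respects↭ (λ σ → 𝟙 ((μ ++ σ) ≈ₘ? la))
    𝟙++-respʳ μ la _ p = 𝟙≈ₘ-respˡ la (↭P.++⁺ˡ μ p)

    𝟙++-respˡ : ∀ σ la → Respects↭ (λ ρ → 𝟙 ((ρ ++ σ) ≈ₘ? la))
    𝟙++-respˡ σ la _ p = 𝟙≈ₘ-respˡ la (↭P.++⁺ʳ σ p)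

    𝟙++-largerʳ : ∀ K la → sum la ≤ K → ∀ μ σ → K < sum σ → 𝟙 ((μ ++ σ) ≈ₘ? la) ≡ 0ℚ
    𝟙++-largerʳ K la la≤K μ σ K<σ = 𝟙≈ₘ-larger (μ ++ σ) la (ℕP.<-≤-trans (ℕP.≤-<-trans la≤K K<σ)
      (subst (sum σ ≤_) (sym (sum-++ μ σ)) (ℕP.m≤n+m (sum σ) (sum μ))))

    𝟙++-largerˡ : ∀ K la → sum la ≤ K → ∀ σ ρ → K < sum ρ → 𝟙 ((ρ ++ σ) ≈ₘ? la) ≡ 0ℚ
    𝟙++-largerˡ K la la≤K σ ρ K<ρ = 𝟙≈ₘ-larger (ρ ++ σ) la (ℕP.<-≤-trans (ℕP.≤-<-trans la≤K K<ρ)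
      (subst (sum ρ ≤_) (sym (sum-++ ρ σ)) (ℕP.m≤m+n (sum ρ) (sum σ))))

  coeff-⊗ : ∀ K la → sum la ≤ K → ∀ P Q → Positive P → Positive Q →
            coeff la (P ⊗ Q) ≡ Σ (partitionsUpTo K) (λ ρ → Σ (partitionsUpTo K) (λ σ → 𝟙 ((ρ ++ σ) ≈ₘ? la) * (coeff ρ P * coeff σ Q)))
  coeff-⊗ K la la≤K P Q P-pos Q-pos = begin
    coeff la (P ⊗ Q) ≡⟨ coeff-⊗-terms la P Q ⟩
    Σ P (λ t → Σ Q (λ s → 𝟙 ((proj₁ t ++ proj₁ s) ≈ₘ? la) * (proj₂ t * proj₂ s)))
      ≡⟨ Σ-cong P (λ t → trans (Σ-cong Q (λ s → ℚ*.x∙yz≈y∙zx (𝟙 ((proj₁ t ++ proj₁ s) ≈ₘ? la)) (proj₂ t) (proj₂ s)))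
                               (sym (*-distribˡ-Σ (proj₂ t) Q _))) ⟩
    Σ P (λ t → proj₂ t * Σ Q (λ s → proj₂ s * 𝟙 ((proj₁ t ++ proj₁ s) ≈ₘ? la)))
      ≡⟨ Σ-cong P (λ t → cong (proj₂ t *_) (Σ-terms≡Σ-coeff K Q Q-pos (λ σ → 𝟙 ((proj₁ t ++ σ) ≈ₘ? la))
                                              (𝟙++-respʳ (proj₁ t) la) (𝟙++-largerʳ K la la≤K (proj₁ t)))) ⟩
    Σ P (λ t → proj₂ t * Σ Pₖ (λ σ → coeff σ Q * 𝟙 ((proj₁ t ++ σ) ≈ₘ? la)))
      ≡⟨ Σ-cong P (λ t → *-distribˡ-Σ (proj₂ t) Pₖ _) ⟩
    Σ P (λ t → Σ Pₖ (λ σ → proj₂ t * (coeff σ Q * 𝟙 ((proj₁ t ++ σ) ≈ₘ? la))))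
      ≡⟨ Σ-comm P Pₖ (λ t σ → proj₂ t * (coeff σ Q * 𝟙 ((proj₁ t ++ σ) ≈ₘ? la))) ⟩
    Σ Pₖ (λ σ → Σ P (λ t → proj₂ t * (coeff σ Q * 𝟙 ((proj₁ t ++ σ) ≈ₘ? la))))
      ≡⟨ Σ-cong Pₖ (λ σ → trans (Σ-cong P (λ t → ℚ*.x∙yz≈y∙xz (proj₂ t) (coeff σ Q) (𝟙 ((proj₁ t ++ σ) ≈ₘ? la))))
                               (sym (*-distribˡ-Σ (coeff σ Q) P _))) ⟩
    Σ Pₖ (λ σ → coeff σ Q * Σ P (λ t → proj₂ t * 𝟙 ((proj₁ t ++ σ) ≈ₘ? la)))
      ≡⟨ Σ-cong Pₖ (λ σ → cong (coeff σ Q *_) (Σ-terms≡Σ-coeff K P P-pos (λ ρ → 𝟙 ((ρ ++ σ) ≈ₘ? la))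
                                                 (𝟙++-respˡ σ la) (𝟙++-largerˡ K la la≤K σ))) ⟩
    Σ Pₖ (λ σ → coeff σ Q * Σ Pₖ (λ ρ → coeff ρ P * 𝟙 ((ρ ++ σ) ≈ₘ? la)))
      ≡⟨ Σ-cong Pₖ (λ σ → trans (*-distribˡ-Σ (coeff σ Q) Pₖ _)
                               (Σ-cong Pₖ (λ ρ → ℚ*.x∙yz≈z∙yx (coeff σ Q) (coeff ρ P) (𝟙 ((ρ ++ σ) ≈ₘ? la))))) ⟩
    Σ Pₖ (λ σ → Σ Pₖ (λ ρ → 𝟙 ((ρ ++ σ) ≈ₘ? la) * (coeff ρ P * coeff σ Q)))
      ≡⟨ Σ-comm Pₖ Pₖ (λ σ ρ → 𝟙 ((ρ ++ σ) ≈ₘ? la) * (coeff ρ P * coeff σ Q)) ⟩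
    Σ Pₖ (λ ρ → Σ Pₖ (λ σ → 𝟙 ((ρ ++ σ) ≈ₘ? la) * (coeff ρ P * coeff σ Q))) ∎
    where
    Pₖ = partitionsUpTo K

  coeff-concatMap : ∀ {A : Set} la (f : A → Sym) (xs : List A) → coeff la (concatMap f xs) ≡ Σ xs (λ x → coeff la (f x))
  coeff-concatMap la f xs = trans (coeff-Σ la (concatMap f xs))
    (trans (Σ-concatMap f xs _) (Σ-cong xs (λ x → sym (coeff-Σ la (f x)))))

  coeff-scale : ∀ la c P → coeff la (scale c P) ≡ c * coeff la P
  coeff-scale la c P = begin
    coeff la (scale c P) ≡⟨ coeff-Σ la (scale c P) ⟩
    Σ (scale c P) (λ t → 𝟙 (proj₁ t ≈ₘ? la) * proj₂ t) ≡⟨ Σ-scale c P _ ⟩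
    Σ P (λ t → 𝟙 (proj₁ t ≈ₘ? la) * (c * proj₂ t)) ≡⟨ Σ-cong P (λ t → ℚ*.x∙yz≈y∙xz (𝟙 (proj₁ t ≈ₘ? la)) c (proj₂ t)) ⟩
    Σ P (λ t → c * (𝟙 (proj₁ t ≈ₘ? la) * proj₂ t)) ≡⟨ *-distribˡ-Σ c P _ ⟨
    c * Σ P (λ t → 𝟙 (proj₁ t ≈ₘ? la) * proj₂ t) ≡⟨ cong (c *_) (coeff-Σ la P) ⟨
    c * coeff la P ∎

  coeff-h : ∀ k la → All (0 <_) la → coeff la (h k) ≡ 𝟙 (sum la ≟ k) * inv (z la)
  coeff-h k la pos = begin
    coeff la (h k) ≡⟨ coeff-Σ la (h k) ⟩
    Σ (h k) (λ t → 𝟙 (proj₁ t ≈ₘ? la) * proj₂ t) ≡⟨ Σ-map (λ ρ → ρ , inv (z ρ)) (partitions k) _ ⟩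
    Σ (partitions k) (λ ρ → 𝟙 (ρ ≈ₘ? la) * inv (z ρ))
      ≡⟨ Σ-cong (partitions k) (λ ρ → cong (_* inv (z ρ)) (𝟙-⇔ (ρ ≈ₘ? la) (la ≈ₘ? ρ) sym sym)) ⟩
    Σ (partitions k) (λ ρ → 𝟙 (la ≈ₘ? ρ) * inv (z ρ))
      ≡⟨ Σ-partitions-δ k la pos (inv ∘ z) (λ _ p → cong inv (z-↭ p)) ⟩
    𝟙 (sum la ≟ k) * inv (z la) ∎

  coeff-pleth-terms : ∀ la X A → coeff la (pleth X A) ≡ Σ X (λ t → proj₂ t * coeff la (pν (proj₁ t) A))
  coeff-pleth-terms la X A = begin
    coeff la (pleth X A) ≡⟨ coeff-Σ la (pleth X A) ⟩
    Σ (pleth X A) F ≡⟨ Σ-pleth X A F ⟩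
    Σ X (λ t → Σ (scale (proj₂ t) (pν (proj₁ t) A)) F)
      ≡⟨ Σ-cong X (λ t → trans (sym (coeff-Σ la (scale (proj₂ t) (pν (proj₁ t) A)))) (coeff-scale la (proj₂ t) (pν (proj₁ t) A))) ⟩
    Σ X (λ t → proj₂ t * coeff la (pν (proj₁ t) A)) ∎
    where
    F : List ℕ × ℚ → ℚ
    F t = 𝟙 (proj₁ t ≈ₘ? la) * proj₂ t

  coeff-trunc : ∀ N P la → coeff la (trunc N P) ≡ 𝟙 (sum la ≤? N) * coeff la P
  coeff-trunc N P la = begin
    coeff la (trunc N P) ≡⟨ coeff-Σ la (trunc N P) ⟩
    Σ (trunc N P) (λ t → 𝟙 (proj₁ t ≈ₘ? la) * proj₂ t)
      ≡⟨ Σ-filter (λ { (μ , a) → sum μ ≤? N }) P _ ⟩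
    Σ P (λ t → 𝟙 (sum (proj₁ t) ≤? N) * (𝟙 (proj₁ t ≈ₘ? la) * proj₂ t))
      ≡⟨ Σ-cong P (λ t → same-degree (proj₁ t) (proj₂ t)) ⟩
    Σ P (λ t → 𝟙 (sum la ≤? N) * (𝟙 (proj₁ t ≈ₘ? la) * proj₂ t))
      ≡⟨ *-distribˡ-Σ (𝟙 (sum la ≤? N)) P _ ⟨
    𝟙 (sum la ≤? N) * Σ P (λ t → 𝟙 (proj₁ t ≈ₘ? la) * proj₂ t) ≡⟨ cong (𝟙 (sum la ≤? N) *_) (coeff-Σ la P) ⟨
    𝟙 (sum la ≤? N) * coeff la P ∎
    where
    same-degree : ∀ μ a → 𝟙 (sum μ ≤? N) * (𝟙 (μ ≈ₘ? la) * a) ≡ 𝟙 (sum la ≤? N) * (𝟙 (μ ≈ₘ? la) * a)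
    same-degree μ a = trans (ℚ*.x∙yz≈y∙xz (𝟙 (sum μ ≤? N)) (𝟙 (μ ≈ₘ? la)) a) (trans (𝟙-guard (μ ≈ₘ? la) λ e →
        cong (_* a) (𝟙-⇔ (sum μ ≤? N) (sum la ≤? N) (subst (_≤ N) (≈ₘ-sum {μ} {la} e)) (subst (_≤ N) (sym (≈ₘ-sum {μ} {la} e)))))
      (ℚ*.x∙yz≈y∙xz (𝟙 (μ ≈ₘ? la)) (𝟙 (sum la ≤? N)) a))

  module _ (k-1 : ℕ) where

    private
      k = suc k-1

      div-mul : ∀ μ → map (λ x → x ℕ./ k) (map (k ℕ.*_) μ) ≡ μ
      div-mul [] = refl
      div-mul (x ∷ μ) = cong₂ _∷_ (trans (cong (ℕ._/ k) (ℕP.*-comm k x)) (m*n/n≡m x k)) (div-mul μ)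

      divisible-map : ∀ μ → All (k ∣_) (map (k ℕ.*_) μ)
      divisible-map [] = []
      divisible-map (x ∷ μ) = m∣m*n x ∷ divisible-map μ

    mul-div : ∀ la → All (k ∣_) la → map (k ℕ.*_) (map (λ x → x ℕ./ k) la) ≡ la
    mul-div [] [] = refl
    mul-div (x ∷ la) (k∣x ∷ k∣la) = cong₂ _∷_ (m*[n/m]≡n k∣x) (mul-div la k∣la)

    𝟙-≈ₘ-map-* : ∀ μ la → 𝟙 (map (k ℕ.*_) μ ≈ₘ? la) ≡ 𝟙 (all? (k ∣?_) la) * 𝟙 (μ ≈ₘ? map (λ x → x ℕ./ k) la)
    𝟙-≈ₘ-map-* μ la = trans (𝟙-⇔ (map (k ℕ.*_) μ ≈ₘ? la) (all? (k ∣?_) la ×-dec (μ ≈ₘ? map (λ x → x ℕ./ k) la))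
      (λ e → let p = ≈ₘ⇒↭ {map (k ℕ.*_) μ} {la} e in
        ↭P.All-resp-↭ p (divisible-map μ) , ↭⇒≈ₘ (↭-trans (↭-reflexive (sym (div-mul μ))) (↭P.map⁺ (λ x → x ℕ./ k) p)))
      (λ { (k∣la , e) → ↭⇒≈ₘ (↭-trans (↭P.map⁺ (k ℕ.*_) (≈ₘ⇒↭ {μ} {map (λ x → x ℕ./ k) la} e)) (↭-reflexive (mul-div la k∣la))) }))
      (𝟙-× (all? (k ∣?_) la) (μ ≈ₘ? map (λ x → x ℕ./ k) la))

    coeff-pk : ∀ la P → coeff la (pk k P) ≡ 𝟙 (all? (k ∣?_) la) * coeff (map (λ x → x ℕ./ k) la) P
    coeff-pk la P = begin
      coeff la (pk k P) ≡⟨ coeff-Σ la (pk k P) ⟩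
      Σ (pk k P) (λ t → 𝟙 (proj₁ t ≈ₘ? la) * proj₂ t) ≡⟨ Σ-pk k P _ ⟩
      Σ P (λ t → 𝟙 (map (k ℕ.*_) (proj₁ t) ≈ₘ? la) * proj₂ t)
        ≡⟨ Σ-cong P (λ t → trans (cong (_* proj₂ t) (𝟙-≈ₘ-map-* (proj₁ t) la)) (ℚP.*-assoc (𝟙 (all? (k ∣?_) la)) (𝟙 (proj₁ t ≈ₘ? map (λ x → x ℕ./ k) la)) (proj₂ t))) ⟩
      Σ P (λ t → 𝟙 (all? (k ∣?_) la) * (𝟙 (proj₁ t ≈ₘ? map (λ x → x ℕ./ k) la) * proj₂ t))
        ≡⟨ *-distribˡ-Σ (𝟙 (all? (k ∣?_) la)) P _ ⟨
      𝟙 (all? (k ∣?_) la) * Σ P (λ t → 𝟙 (proj₁ t ≈ₘ? map (λ x → x ℕ./ k) la) * proj₂ t)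
        ≡⟨ cong (𝟙 (all? (k ∣?_) la) *_) (coeff-Σ (map (λ x → x ℕ./ k) la) P) ⟨
      𝟙 (all? (k ∣?_) la) * coeff (map (λ x → x ℕ./ k) la) P ∎

module SeriesInvariants where

  open PartitionEnumeration using (All-concatMap; partitions-isPartition; partitions-sum)
  open Intervals using (range1-bounds)
  open Coefficients

  private
    All-⊗ : ∀ (Pr : List ℕ × ℚ → Set) (P Q : Sym) →
            All (λ t → All (λ s → Pr (proj₁ t ++ proj₁ s , proj₂ t * proj₂ s)) Q) P → All Pr (P ⊗ Q)
    All-⊗ Pr [] Q [] = []
    All-⊗ Pr ((μ , a) ∷ P) Q (q ∷ qs) = AllP.++⁺ (AllP.map⁺ q) (All-⊗ Pr P Q qs)

    All-scale : ∀ (Pr : List ℕ → Set) c P → All (Pr ∘ proj₁) P → All (Pr ∘ proj₁) (scale c P)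
    All-scale Pr c [] [] = []
    All-scale Pr c ((μ , a) ∷ P) (p ∷ ps) = p ∷ All-scale Pr c P ps

    All-pk : ∀ (Pr : List ℕ → Set) k P → All (λ t → Pr (map (k ℕ.*_) (proj₁ t))) P → All (Pr ∘ proj₁) (pk k P)
    All-pk Pr k [] [] = []
    All-pk Pr k ((μ , a) ∷ P) (p ∷ ps) = p ∷ All-pk Pr k P ps

    All-pleth : ∀ (Pr : List ℕ → Set) X A → All (λ t → All (Pr ∘ proj₁) (pν (proj₁ t) A)) X → All (Pr ∘ proj₁) (pleth X A)
    All-pleth Pr [] A [] = []
    All-pleth Pr ((μ , a) ∷ X) A (p ∷ ps) = AllP.++⁺ (All-scale Pr a _ p) (All-pleth Pr X A ps)

  Positive-⊗ : ∀ P Q → Positive P → Positive Q → Positive (P ⊗ Q)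
  Positive-⊗ P Q P-pos Q-pos = All-⊗ _ P Q (All.map (λ t-pos → All.map (AllP.++⁺ t-pos) Q-pos) P-pos)

  Positive-prodS : ∀ Ps → All Positive Ps → Positive (prodS Ps)
  Positive-prodS [] [] = [] ∷ []
  Positive-prodS (P ∷ Ps) (p ∷ ps) = Positive-⊗ P (prodS Ps) p (Positive-prodS Ps ps)

  Positive-pk : ∀ k P → 0 < k → Positive P → Positive (pk k P)
  Positive-pk k P k>0 P-pos = All-pk _ k P (All.map (λ t-pos → AllP.map⁺ (All.map (ℕP.*-mono-≤ k>0) t-pos)) P-pos)

  Positive-pks : ∀ A ν → All (0 <_) ν → Positive A → All Positive (map (λ k → pk k A) ν)
  Positive-pks A ν ν-pos A-pos = AllP.map⁺ (All.map (λ {k} k>0 → Positive-pk k A k>0 A-pos) ν-pos)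

  Positive-pν : ∀ A ν → All (0 <_) ν → Positive A → Positive (pν ν A)
  Positive-pν A ν ν-pos A-pos = Positive-prodS _ (Positive-pks A ν ν-pos A-pos)

  Positive-pleth : ∀ X A → Positive X → Positive A → Positive (pleth X A)
  Positive-pleth X A X-pos A-pos = All-pleth _ X A (All.map (λ {t} t-pos → Positive-pν A (proj₁ t) t-pos A-pos) X-pos)

  Positive-h : ∀ k → Positive (h k)
  Positive-h k = AllP.map⁺ (All.map proj₁ (partitions-isPartition k))

  Positive-Σh : ∀ ks → Positive (concatMap h ks)
  Positive-Σh ks = All-concatMap h (All.universal Positive-h ks)

  Positive-Ω₀iter : ∀ m N → Positive (Ω₀iter m N)
  Positive-Ω₀iter zero N = Positive-h 1
  Positive-Ω₀iter (suc m) N = AllP.filter⁺ _ (Positive-pleth (Ω₀UpTo N) (Ω₀iter m N) (Positive-Σh (range1 N)) (Positive-Ω₀iter m N))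

  MinDegree-weaken : ∀ {d e} P → d ≤ e → MinDegree e P → MinDegree d P
  MinDegree-weaken P d≤e = All.map (ℕP.≤-trans d≤e)

  MinDegree-⊗ : ∀ d e P Q → MinDegree d P → MinDegree e Q → MinDegree (d ℕ.+ e) (P ⊗ Q)
  MinDegree-⊗ d e P Q P≥d Q≥e = All-⊗ _ P Q (All.map (λ {t} d≤t → All.map (λ {s} e≤s →
    subst (d ℕ.+ e ≤_) (sym (sum-++ (proj₁ t) (proj₁ s))) (ℕP.+-mono-≤ d≤t e≤s)) Q≥e) P≥d)

  sum-map-* : ∀ k μ → sum (map (k ℕ.*_) μ) ≡ k ℕ.* sum μ
  sum-map-* k [] = sym (ℕP.*-zeroʳ k)
  sum-map-* k (x ∷ μ) = trans (cong (k ℕ.* x ℕ.+_) (sum-map-* k μ)) (sym (ℕP.*-distribˡ-+ k x (sum μ)))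

  MinDegree-pk : ∀ d k P → MinDegree d P → MinDegree (k ℕ.* d) (pk k P)
  MinDegree-pk d k P P≥d = All-pk _ k P (All.map (λ {t} d≤t → subst (k ℕ.* d ≤_) (sym (sum-map-* k (proj₁ t))) (ℕP.*-monoʳ-≤ k d≤t)) P≥d)

  MinDegree-pν : ∀ A ν → MinDegree 1 A → MinDegree (sum ν) (pν ν A)
  MinDegree-pν A [] A≥1 = z≤n ∷ []
  MinDegree-pν A (k ∷ ν) A≥1 = subst (λ d → MinDegree (d ℕ.+ sum ν) (pν (k ∷ ν) A)) (ℕP.*-identityʳ k)
    (MinDegree-⊗ (k ℕ.* 1) (sum ν) (pk k A) (pν ν A) (MinDegree-pk 1 k A A≥1) (MinDegree-pν A ν A≥1))

  MinDegree-pleth : ∀ d X A → MinDegree d X → MinDegree 1 A → MinDegree d (pleth X A)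
  MinDegree-pleth d X A X≥d A≥1 =
    All-pleth (λ μ → d ≤ sum μ) X A (All.map (λ {t} d≤t → MinDegree-weaken _ d≤t (MinDegree-pν A (proj₁ t) A≥1)) X≥d)

  MinDegree-h : ∀ k → MinDegree k (h k)
  MinDegree-h k = AllP.map⁺ (All.map (λ e → ℕP.≤-reflexive (sym e)) (partitions-sum k))

  MinDegree-Ω₀ : ∀ N → MinDegree 1 (Ω₀UpTo N)
  MinDegree-Ω₀ N = All-concatMap h (All.map (λ { {k} (k≥1 , _) → MinDegree-weaken (h k) k≥1 (MinDegree-h k) }) (range1-bounds N))

  MinDegree-Ω₀iter : ∀ m N → MinDegree 1 (Ω₀iter m N)
  MinDegree-Ω₀iter zero N = MinDegree-h 1
  MinDegree-Ω₀iter (suc m) N = AllP.filter⁺ _ (MinDegree-pleth 1 (Ω₀UpTo N) (Ω₀iter m N) (MinDegree-Ω₀ N) (MinDegree-Ω₀iter m N))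

module CoefficientAlgebra where

  open FiniteSums
  open Multisets
  open PartitionEnumeration
  open Coefficients
  open SeriesInvariants

  infix 4 _≈ᶜ_ _≈[≤_]_

  _≈ᶜ_ : Sym → Sym → Set
  P ≈ᶜ Q = ∀ la → coeff la P ≡ coeff la Q

  _≈[≤_]_ : Sym → ℕ → Sym → Set
  P ≈[≤ K ] Q = ∀ la → sum la ≤ K → coeff la P ≡ coeff la Q

  ⊗-cong≤ : ∀ K {P P' Q Q'} → Positive P → Positive P' → Positive Q → Positive Q' →
            P ≈[≤ K ] P' → Q ≈[≤ K ] Q' → P ⊗ Q ≈[≤ K ] P' ⊗ Q'
  ⊗-cong≤ K {P} {P'} {Q} {Q'} P-pos P'-pos Q-pos Q'-pos P≈P' Q≈Q' la la≤K = begin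
    coeff la (P ⊗ Q) ≡⟨ coeff-⊗ K la la≤K P Q P-pos Q-pos ⟩
    Σ Pₖ (λ ρ → Σ Pₖ (λ σ → 𝟙 ((ρ ++ σ) ≈ₘ? la) * (coeff ρ P * coeff σ Q)))
      ≡⟨ Σ-cong-All (All.map (λ {ρ} ρ≤K → Σ-cong-All (All.map (λ {σ} σ≤K →
           cong (𝟙 ((ρ ++ σ) ≈ₘ? la) *_) (cong₂ _*_ (P≈P' ρ ρ≤K) (Q≈Q' σ σ≤K))) (partitionsUpTo-sum≤ K))) (partitionsUpTo-sum≤ K)) ⟩
    Σ Pₖ (λ ρ → Σ Pₖ (λ σ → 𝟙 ((ρ ++ σ) ≈ₘ? la) * (coeff ρ P' * coeff σ Q')))
      ≡⟨ coeff-⊗ K la la≤K P' Q' P'-pos Q'-pos ⟨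
    coeff la (P' ⊗ Q') ∎
    where
    Pₖ = partitionsUpTo K

  ⊗-cong : ∀ {P P' Q Q'} → Positive P → Positive P' → Positive Q → Positive Q' → P ≈ᶜ P' → Q ≈ᶜ Q' → P ⊗ Q ≈ᶜ P' ⊗ Q'
  ⊗-cong P-pos P'-pos Q-pos Q'-pos P≈P' Q≈Q' la =
    ⊗-cong≤ (sum la) P-pos P'-pos Q-pos Q'-pos (λ ρ _ → P≈P' ρ) (λ σ _ → Q≈Q' σ) la ℕP.≤-refl

  ⊗ʳ-cong : ∀ {P Q Q'} → Positive P → Positive Q → Positive Q' → Q ≈ᶜ Q' → P ⊗ Q ≈ᶜ P ⊗ Q'
  ⊗ʳ-cong P-pos Q-pos Q'-pos = ⊗-cong P-pos P-pos Q-pos Q'-pos (λ _ → refl)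

  private
    coeff-⊗⊗-terms : ∀ la X Y Z → coeff la (X ⊗ (Y ⊗ Z)) ≡
      Σ X (λ x → Σ Y (λ y → Σ Z (λ w → 𝟙 ((proj₁ x ++ (proj₁ y ++ proj₁ w)) ≈ₘ? la) * (proj₂ x * (proj₂ y * proj₂ w)))))
    coeff-⊗⊗-terms la X Y Z = trans (coeff-⊗-terms la X (Y ⊗ Z))
      (Σ-cong X (λ x → Σ-⊗ Y Z (λ s → 𝟙 ((proj₁ x ++ proj₁ s) ≈ₘ? la) * (proj₂ x * proj₂ s))))

  ⊗-left-comm : ∀ X Y Z → X ⊗ (Y ⊗ Z) ≈ᶜ Y ⊗ (X ⊗ Z)
  ⊗-left-comm X Y Z la = begin
    coeff la (X ⊗ (Y ⊗ Z)) ≡⟨ coeff-⊗⊗-terms la X Y Z ⟩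
    Σ X (λ x → Σ Y (λ y → Σ Z (λ w → 𝟙 ((proj₁ x ++ (proj₁ y ++ proj₁ w)) ≈ₘ? la) * (proj₂ x * (proj₂ y * proj₂ w)))))
      ≡⟨ Σ-comm X Y _ ⟩
    Σ Y (λ y → Σ X (λ x → Σ Z (λ w → 𝟙 ((proj₁ x ++ (proj₁ y ++ proj₁ w)) ≈ₘ? la) * (proj₂ x * (proj₂ y * proj₂ w)))))
      ≡⟨ Σ-cong Y (λ y → Σ-cong X (λ x → Σ-cong Z (λ w → cong₂ _*_
            (𝟙≈ₘ-respˡ la (++-left-comm (proj₁ x) (proj₁ y) (proj₁ w))) (ℚ*.x∙yz≈y∙xz (proj₂ x) (proj₂ y) (proj₂ w))))) ⟩
    Σ Y (λ y → Σ X (λ x → Σ Z (λ w → 𝟙 ((proj₁ y ++ (proj₁ x ++ proj₁ w)) ≈ₘ? la) * (proj₂ y * (proj₂ x * proj₂ w)))))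
      ≡⟨ coeff-⊗⊗-terms la Y X Z ⟨
    coeff la (Y ⊗ (X ⊗ Z)) ∎
    where
    ++-left-comm : ∀ a b c → (a ++ (b ++ c)) ↭ (b ++ (a ++ c))
    ++-left-comm a b c = ↭-trans (↭-reflexive (sym (ListP.++-assoc a b c)))
      (↭-trans (↭P.++⁺ʳ c (↭P.++-comm a b)) (↭-reflexive (ListP.++-assoc b a c)))

  ⊗-assoc : ∀ X Y Z → (X ⊗ Y) ⊗ Z ≈ᶜ X ⊗ (Y ⊗ Z)
  ⊗-assoc X Y Z la = begin
    coeff la ((X ⊗ Y) ⊗ Z) ≡⟨ coeff-⊗-terms la (X ⊗ Y) Z ⟩
    Σ (X ⊗ Y) (λ s → Σ Z (λ w → 𝟙 ((proj₁ s ++ proj₁ w) ≈ₘ? la) * (proj₂ s * proj₂ w))) ≡⟨ Σ-⊗ X Y _ ⟩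
    Σ X (λ x → Σ Y (λ y → Σ Z (λ w → 𝟙 (((proj₁ x ++ proj₁ y) ++ proj₁ w) ≈ₘ? la) * ((proj₂ x * proj₂ y) * proj₂ w))))
      ≡⟨ Σ-cong X (λ x → Σ-cong Y (λ y → Σ-cong Z (λ w → cong₂ (λ l q → 𝟙 (l ≈ₘ? la) * q)
            (ListP.++-assoc (proj₁ x) (proj₁ y) (proj₁ w)) (ℚP.*-assoc (proj₂ x) (proj₂ y) (proj₂ w))))) ⟩
    Σ X (λ x → Σ Y (λ y → Σ Z (λ w → 𝟙 ((proj₁ x ++ (proj₁ y ++ proj₁ w)) ≈ₘ? la) * (proj₂ x * (proj₂ y * proj₂ w)))))
      ≡⟨ coeff-⊗⊗-terms la X Y Z ⟨
    coeff la (X ⊗ (Y ⊗ Z)) ∎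

  oneS-⊗ : ∀ X → oneS ⊗ X ≈ᶜ X
  oneS-⊗ X la = trans (coeff-⊗-terms la oneS X) (trans (ℚP.+-identityʳ _)
    (trans (Σ-cong X (λ s → cong (𝟙 (proj₁ s ≈ₘ? la) *_) (ℚP.*-identityˡ (proj₂ s)))) (sym (coeff-Σ la X))))

  ⊗-oneS : ∀ X → X ⊗ oneS ≈ᶜ X
  ⊗-oneS X la = trans (coeff-⊗-terms la X oneS) (trans (Σ-cong X (λ t → trans (ℚP.+-identityʳ _)
    (cong₂ (λ l q → 𝟙 (l ≈ₘ? la) * q) (ListP.++-identityʳ (proj₁ t)) (ℚP.*-identityʳ (proj₂ t))))) (sym (coeff-Σ la X)))

  coeff-oneS : ∀ la → la ≢ [] → coeff la oneS ≡ 0ℚ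
  coeff-oneS la la≢[] = trans (coeff-Σ la oneS) (trans (ℚP.+-identityʳ (𝟙 ([] ≈ₘ? la) * 1ℚ))
    (𝟙-no-* ([] ≈ₘ? la) (λ e → la≢[] (↭P.↭-empty-inv (↭-sym (≈ₘ⇒↭ {[]} {la} e))))))

  coeff-scale-⊗ : ∀ la a b P Q → coeff la (scale a P ⊗ scale b Q) ≡ (a * b) * coeff la (P ⊗ Q)
  coeff-scale-⊗ la a b P Q = begin
    coeff la (scale a P ⊗ scale b Q)
      ≡⟨ coeff-⊗-terms la (scale a P) (scale b Q) ⟩
    Σ (scale a P) (λ t → Σ (scale b Q) (λ s → F t s))
      ≡⟨ Σ-scale a P _ ⟩
    Σ P (λ t → Σ (scale b Q) (λ s → 𝟙 ((proj₁ t ++ proj₁ s) ≈ₘ? la) * ((a * proj₂ t) * proj₂ s)))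
      ≡⟨ Σ-cong P (λ t → trans (Σ-scale b Q _) (Σ-cong Q (λ s → rearrange (𝟙 ((proj₁ t ++ proj₁ s) ≈ₘ? la)) a b (proj₂ t) (proj₂ s)))) ⟩
    Σ P (λ t → Σ Q (λ s → (a * b) * F t s))
      ≡⟨ Σ-cong P (λ t → *-distribˡ-Σ (a * b) Q (F t)) ⟨
    Σ P (λ t → (a * b) * Σ Q (F t))
      ≡⟨ *-distribˡ-Σ (a * b) P _ ⟨
    (a * b) * Σ P (λ t → Σ Q (F t))
      ≡⟨ cong ((a * b) *_) (coeff-⊗-terms la P Q) ⟨
    (a * b) * coeff la (P ⊗ Q) ∎
    where
    F : List ℕ × ℚ → List ℕ × ℚ → ℚ
    F t s = 𝟙 ((proj₁ t ++ proj₁ s) ≈ₘ? la) * (proj₂ t * proj₂ s)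
    rearrange : ∀ i a b p q → i * ((a * p) * (b * q)) ≡ (a * b) * (i * (p * q))
    rearrange = solve 5 (λ i a b p q → i ⊗ₑ ((a ⊗ₑ p) ⊗ₑ (b ⊗ₑ q)) ⊜ (a ⊗ₑ b) ⊗ₑ (i ⊗ₑ (p ⊗ₑ q))) refl
      where open ℚ-Solver

  coeff-concatMap-⊗ : ∀ {A B : Set} la (f : A → Sym) (g : B → Sym) xs ys →
                      coeff la (concatMap f xs ⊗ concatMap g ys) ≡ Σ xs (λ x → Σ ys (λ y → coeff la (f x ⊗ g y)))
  coeff-concatMap-⊗ la f g xs ys = begin
    coeff la (concatMap f xs ⊗ concatMap g ys)
      ≡⟨ coeff-⊗-terms la (concatMap f xs) (concatMap g ys) ⟩
    Σ (concatMap f xs) (λ t → Σ (concatMap g ys) (F t))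
      ≡⟨ Σ-concatMap f xs _ ⟩
    Σ xs (λ x → Σ (f x) (λ t → Σ (concatMap g ys) (F t)))
      ≡⟨ Σ-cong xs (λ x → Σ-cong (f x) (λ t → Σ-concatMap g ys (F t))) ⟩
    Σ xs (λ x → Σ (f x) (λ t → Σ ys (λ y → Σ (g y) (F t))))
      ≡⟨ Σ-cong xs (λ x → Σ-comm (f x) ys (λ t y → Σ (g y) (F t))) ⟩
    Σ xs (λ x → Σ ys (λ y → Σ (f x) (λ t → Σ (g y) (F t))))
      ≡⟨ Σ-cong xs (λ x → Σ-cong ys (λ y → coeff-⊗-terms la (f x) (g y))) ⟨
    Σ xs (λ x → Σ ys (λ y → coeff la (f x ⊗ g y))) ∎
    where
    F : List ℕ × ℚ → List ℕ × ℚ → ℚ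
    F t s = 𝟙 ((proj₁ t ++ proj₁ s) ≈ₘ? la) * (proj₂ t * proj₂ s)

  pν-resp-↭ : ∀ {A} → Positive A → ∀ {a b} → All (0 <_) b → a ↭ b → pν a A ≈ᶜ pν b A
  pν-resp-↭ A-pos b-pos ↭.refl la = refl
  pν-resp-↭ {A} A-pos (x>0 ∷ ys-pos) (↭.prep {xs} {ys} x p) =
    ⊗ʳ-cong (Positive-pk x A x>0 A-pos) (Positive-pν A xs (↭P.All-resp-↭ (↭-sym p) ys-pos) A-pos) (Positive-pν A ys ys-pos A-pos)
      (pν-resp-↭ A-pos ys-pos p)
  pν-resp-↭ {A} A-pos (y>0 ∷ x>0 ∷ ys-pos) (↭.swap {xs} {ys} x y p) la =
    trans (⊗-left-comm (pk x A) (pk y A) (pν xs A) la)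
      (⊗ʳ-cong (Positive-pk y A y>0 A-pos) (Positive-pν A (x ∷ xs) (x>0 ∷ xs-pos) A-pos) (Positive-pν A (x ∷ ys) (x>0 ∷ ys-pos) A-pos)
        (⊗ʳ-cong (Positive-pk x A x>0 A-pos) (Positive-pν A xs xs-pos A-pos) (Positive-pν A ys ys-pos A-pos) (pν-resp-↭ A-pos ys-pos p)) la)
    where
    xs-pos = ↭P.All-resp-↭ (↭-sym p) ys-pos
  pν-resp-↭ A-pos c-pos (↭.trans p q) la =
    trans (pν-resp-↭ A-pos (↭P.All-resp-↭ (↭-sym q) c-pos) p la) (pν-resp-↭ A-pos c-pos q la)

  coeff-pleth : ∀ K la → sum la ≤ K → ∀ X A → Positive X → Positive A → MinDegree 1 A →
                coeff la (pleth X A) ≡ Σ (partitionsUpTo K) (λ ν → coeff ν X * coeff la (pν ν A))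
  coeff-pleth K la la≤K X A X-pos A-pos A≥1 = trans (coeff-pleth-terms la X A)
    (Σ-terms≡Σ-coeff K X X-pos (λ ν → coeff la (pν ν A)) (λ b-pos p → pν-resp-↭ A-pos b-pos p la)
       (λ ν K<ν → coeff-below-MinDegree (sum ν) (pν ν A) la (MinDegree-pν A ν A≥1) (ℕP.≤-<-trans la≤K K<ν)))

  prodS-++ : ∀ Ps Qs → All Positive Ps → All Positive Qs → prodS (Ps ++ Qs) ≈ᶜ prodS Ps ⊗ prodS Qs
  prodS-++ [] Qs [] Qs-pos = λ la → sym (oneS-⊗ (prodS Qs) la)
  prodS-++ (P ∷ Ps) Qs (P-pos ∷ Ps-pos) Qs-pos la = trans
    (⊗ʳ-cong P-pos (Positive-prodS (Ps ++ Qs) (AllP.++⁺ Ps-pos Qs-pos))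
       (Positive-⊗ (prodS Ps) (prodS Qs) (Positive-prodS Ps Ps-pos) (Positive-prodS Qs Qs-pos)) (prodS-++ Ps Qs Ps-pos Qs-pos) la)
    (sym (⊗-assoc P (prodS Ps) (prodS Qs) la))

  pν-++ : ∀ A μ ν → All (0 <_) μ → All (0 <_) ν → Positive A → pν (μ ++ ν) A ≈ᶜ pν μ A ⊗ pν ν A
  pν-++ A μ ν μ-pos ν-pos A-pos la = trans (cong (λ l → coeff la (prodS l)) (ListP.map-++ (λ k → pk k A) μ ν))
    (prodS-++ (map (λ k → pk k A) μ) (map (λ k → pk k A) ν) (Positive-pks A μ μ-pos A-pos) (Positive-pks A ν ν-pos A-pos) la)

  pleth-⊗ : ∀ X Y A → Positive X → Positive Y → Positive A → pleth (X ⊗ Y) A ≈ᶜ pleth X A ⊗ pleth Y A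
  pleth-⊗ X Y A X-pos Y-pos A-pos la = begin
    coeff la (pleth (X ⊗ Y) A)
      ≡⟨ coeff-pleth-terms la (X ⊗ Y) A ⟩
    Σ (X ⊗ Y) (λ t → proj₂ t * coeff la (pν (proj₁ t) A))
      ≡⟨ Σ-⊗ X Y _ ⟩
    Σ X (λ x → Σ Y (λ y → (proj₂ x * proj₂ y) * coeff la (pν (proj₁ x ++ proj₁ y) A)))
      ≡⟨ Σ-cong-All (All.map (λ {x} x-pos → Σ-cong-All (All.map (λ {y} y-pos → cong ((proj₂ x * proj₂ y) *_)
            (pν-++ A (proj₁ x) (proj₁ y) x-pos y-pos A-pos la)) Y-pos)) X-pos) ⟩
    Σ X (λ x → Σ Y (λ y → (proj₂ x * proj₂ y) * coeff la (pν (proj₁ x) A ⊗ pν (proj₁ y) A)))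
      ≡⟨ Σ-cong X (λ x → Σ-cong Y (λ y → coeff-scale-⊗ la (proj₂ x) (proj₂ y) (pν (proj₁ x) A) (pν (proj₁ y) A))) ⟨
    Σ X (λ x → Σ Y (λ y → coeff la (scale (proj₂ x) (pν (proj₁ x) A) ⊗ scale (proj₂ y) (pν (proj₁ y) A))))
      ≡⟨ coeff-concatMap-⊗ la (λ x → scale (proj₂ x) (pν (proj₁ x) A)) (λ y → scale (proj₂ y) (pν (proj₁ y) A)) X Y ⟨
    coeff la (pleth X A ⊗ pleth Y A) ∎

  pleth-power : ∀ L A n → Positive L → Positive A → pleth (prodS (replicate n L)) A ≈ᶜ prodS (replicate n (pleth L A))
  pleth-power L A zero L-pos A-pos la = trans (coeff-pleth-terms la oneS A) (trans (ℚP.+-identityʳ _) (ℚP.*-identityˡ _))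
  pleth-power L A (suc n) L-pos A-pos la = trans (pleth-⊗ L (prodS (replicate n L)) A L-pos Lⁿ-pos A-pos la)
    (⊗ʳ-cong (Positive-pleth L A L-pos A-pos) (Positive-pleth (prodS (replicate n L)) A Lⁿ-pos A-pos)
       (Positive-prodS _ (AllP.replicate⁺ n (Positive-pleth L A L-pos A-pos))) (pleth-power L A n L-pos A-pos) la)
    where
    Lⁿ-pos = Positive-prodS (replicate n L) (AllP.replicate⁺ n L-pos)

  coeff-pleth-concatMap : ∀ {B : Set} la (f : B → Sym) xs A → coeff la (pleth (concatMap f xs) A) ≡ Σ xs (λ x → coeff la (pleth (f x) A))
  coeff-pleth-concatMap la f xs A = begin
    coeff la (pleth (concatMap f xs) A) ≡⟨ coeff-pleth-terms la (concatMap f xs) A ⟩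
    Σ (concatMap f xs) (λ t → proj₂ t * coeff la (pν (proj₁ t) A)) ≡⟨ Σ-concatMap f xs _ ⟩
    Σ xs (λ x → Σ (f x) (λ t → proj₂ t * coeff la (pν (proj₁ t) A))) ≡⟨ Σ-cong xs (λ x → coeff-pleth-terms la (f x) A) ⟨
    Σ xs (λ x → coeff la (pleth (f x) A)) ∎

  coeff-pleth-scale : ∀ la c P A → coeff la (pleth (scale c P) A) ≡ c * coeff la (pleth P A)
  coeff-pleth-scale la c P A = begin
    coeff la (pleth (scale c P) A) ≡⟨ coeff-pleth-terms la (scale c P) A ⟩
    Σ (scale c P) (λ t → proj₂ t * coeff la (pν (proj₁ t) A)) ≡⟨ Σ-scale c P _ ⟩
    Σ P (λ t → (c * proj₂ t) * coeff la (pν (proj₁ t) A)) ≡⟨ Σ-cong P (λ t → ℚP.*-assoc c (proj₂ t) _) ⟩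
    Σ P (λ t → c * (proj₂ t * coeff la (pν (proj₁ t) A))) ≡⟨ *-distribˡ-Σ c P _ ⟨
    c * Σ P (λ t → proj₂ t * coeff la (pν (proj₁ t) A)) ≡⟨ cong (c *_) (coeff-pleth-terms la P A) ⟨
    c * coeff la (pleth P A) ∎

module ExponentialFormula where

  open Casts
  open FiniteSums
  open Intervals
  open Multisets
  open Coefficients
  open SeriesInvariants
  open CoefficientAlgebra
  open CentralizerOrder using (PartsIn; partsIn-≤; mult-∷-≡; mult-∷-≢; mult-∉; mult-↭; multFactorials; multFactorials-↭;
                               multFactorials-positive; z≡multFactorials*product)
  open import Data.List.Membership.Propositional.Properties using (∈-∃++)
  open import Data.List.Membership.DecPropositional _≟_ using (_∈?_)
  open import Data.List.Relation.Unary.Any using (here)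

  logΩ : ℕ → Sym
  logΩ N = map (λ k → [ k ] , inv k) (range1 N)

  expLogΩ : ℕ → Sym
  expLogΩ N = concatMap (λ n → scale (inv (n !)) (prodS (replicate n (logΩ N)))) (upTo (suc N))

  words : ℕ → ℕ → List (List ℕ)
  words N zero = [ [] ]
  words N (suc n) = concatMap (λ k → map (k ∷_) (words N n)) (range1 N)

  Positive-logΩ : ∀ N → Positive (logΩ N)
  Positive-logΩ N = AllP.map⁺ (All.map (λ { (k>0 , _) → k>0 ∷ [] }) (range1-bounds N))

  MinDegree-logΩ : ∀ N → MinDegree 1 (logΩ N)
  MinDegree-logΩ N = AllP.map⁺ (All.map (λ { {k} (k>0 , _) → subst (1 ≤_) (sym (ℕP.+-identityʳ k)) k>0 }) (range1-bounds N))

  Positive-expLogΩ : ∀ N → Positive (expLogΩ N)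
  Positive-expLogΩ N = PartitionEnumeration.All-concatMap _ (All.universal (λ n →
    AllP.map⁺ (Positive-prodS (replicate n (logΩ N)) (AllP.replicate⁺ n (Positive-logΩ N)))) (upTo (suc N)))

  Σ-logΩ-power : ∀ N n (F : List ℕ × ℚ → ℚ) → Σ (prodS (replicate n (logΩ N))) F ≡ Σ (words N n) (λ w → F (w , prodℚ (map inv w)))
  Σ-logΩ-power N zero F = refl
  Σ-logΩ-power N (suc n) F = begin
    Σ (logΩ N ⊗ prodS (replicate n (logΩ N))) F
      ≡⟨ Σ-⊗ (logΩ N) (prodS (replicate n (logΩ N))) F ⟩
    Σ (logΩ N) (λ t → Σ (prodS (replicate n (logΩ N))) (λ s → F (proj₁ t ++ proj₁ s , proj₂ t * proj₂ s)))
      ≡⟨ Σ-map (λ k → [ k ] , inv k) (range1 N) _ ⟩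
    Σ (range1 N) (λ k → Σ (prodS (replicate n (logΩ N))) (λ s → F (k ∷ proj₁ s , inv k * proj₂ s)))
      ≡⟨ Σ-cong (range1 N) (λ k → trans (Σ-logΩ-power N n (λ s → F (k ∷ proj₁ s , inv k * proj₂ s)))
                                        (sym (Σ-map (k ∷_) (words N n) (λ w → F (w , prodℚ (map inv w)))))) ⟩
    Σ (range1 N) (λ k → Σ (map (k ∷_) (words N n)) (λ w → F (w , prodℚ (map inv w))))
      ≡⟨ Σ-concatMap (λ k → map (k ∷_) (words N n)) (range1 N) (λ w → F (w , prodℚ (map inv w))) ⟨
    Σ (words N (suc n)) (λ w → F (w , prodℚ (map inv w))) ∎

  prodℚ-map-↭ : ∀ (f : ℕ → ℚ) {a b} → a ↭ b → prodℚ (map f a) ≡ prodℚ (map f b)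
  prodℚ-map-↭ f ↭.refl = refl
  prodℚ-map-↭ f (↭.prep x p) = cong (f x *_) (prodℚ-map-↭ f p)
  prodℚ-map-↭ f (↭.swap x y p) = trans (ℚ*.x∙yz≈y∙xz (f x) (f y) _) (cong (λ r → f y * (f x * r)) (prodℚ-map-↭ f p))
  prodℚ-map-↭ f (↭.trans p q) = trans (prodℚ-map-↭ f p) (prodℚ-map-↭ f q)

  coeff-logΩ-power : ∀ N n ν → coeff ν (prodS (replicate n (logΩ N))) ≡ Σ (words N n) (λ w → 𝟙 (w ≈ₘ? ν)) * prodℚ (map inv ν)
  coeff-logΩ-power N n ν = begin
    coeff ν (prodS (replicate n (logΩ N)))
      ≡⟨ coeff-Σ ν (prodS (replicate n (logΩ N))) ⟩
    Σ (prodS (replicate n (logΩ N))) (λ t → 𝟙 (proj₁ t ≈ₘ? ν) * proj₂ t)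
      ≡⟨ Σ-logΩ-power N n _ ⟩
    Σ (words N n) (λ w → 𝟙 (w ≈ₘ? ν) * prodℚ (map inv w))
      ≡⟨ Σ-cong (words N n) (λ w → 𝟙-guard (w ≈ₘ? ν) (λ e → prodℚ-map-↭ inv (≈ₘ⇒↭ {w} {ν} e))) ⟩
    Σ (words N n) (λ w → 𝟙 (w ≈ₘ? ν) * prodℚ (map inv ν))
      ≡⟨ *-distribʳ-Σ (prodℚ (map inv ν)) (words N n) _ ⟨
    Σ (words N n) (λ w → 𝟙 (w ≈ₘ? ν)) * prodℚ (map inv ν) ∎

  Σ-mult≡length : ∀ N ν → PartsIn N ν → Σ (range1 N) (λ x → ℕtoℚ (mult x ν)) ≡ ℕtoℚ (length ν)
  Σ-mult≡length N [] [] = Σ-zero-∀ (range1 N) (λ _ → refl)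
  Σ-mult≡length N (y ∷ ν) ((y≥1 , y≤N) ∷ ν-in) = begin
    Σ (range1 N) (λ x → ℕtoℚ (mult x (y ∷ ν)))
      ≡⟨ Σ-cong (range1 N) mult-∷ ⟩
    Σ (range1 N) (λ x → 𝟙 (x ≟ y) * 1ℚ + ℕtoℚ (mult x ν))
      ≡⟨ Σ-distrib-+ (range1 N) _ _ ⟩
    Σ (range1 N) (λ x → 𝟙 (x ≟ y) * 1ℚ) + Σ (range1 N) (λ x → ℕtoℚ (mult x ν))
      ≡⟨ cong₂ _+_ (trans (cong (λ l → Σ l (λ x → 𝟙 (x ≟ y) * 1ℚ)) (range1≡interval N)) (Σ-interval-δ 1 N y (λ _ → 1ℚ) y≥1 (s≤s y≤N)))
                   (Σ-mult≡length N ν ν-in) ⟩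
    1ℚ + ℕtoℚ (length ν) ≡⟨ ℕtoℚ-+ 1 (length ν) ⟨
    ℕtoℚ (suc (length ν)) ∎
    where
    mult-∷ : ∀ x → ℕtoℚ (mult x (y ∷ ν)) ≡ 𝟙 (x ≟ y) * 1ℚ + ℕtoℚ (mult x ν)
    mult-∷ x with x ≟ y
    ... | yes refl = trans (cong ℕtoℚ (mult-∷-≡ x ν))
      (trans (ℕtoℚ-+ 1 (mult x ν)) (cong (_+ ℕtoℚ (mult x ν)) (sym (𝟙-yes-* (x ≟ x) {1ℚ} refl))))
    ... | no x≢y = trans (cong ℕtoℚ (mult-∷-≢ x y ν (x≢y ∘ sym)))
      (sym (trans (cong (_+ ℕtoℚ (mult x ν)) (𝟙-no-* (x ≟ y) {1ℚ} x≢y)) (ℚP.+-identityˡ _)))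

  -- A multiset ν of n letters from {1,…,N} is the content of exactly n!/∏ⱼ mⱼ(ν)! words.
  WordCount : ℕ → ℕ → List ℕ → Set
  WordCount N n ν = Σ (words N n) (λ w → 𝟙 (w ≈ₘ? ν)) * ℕtoℚ (multFactorials ν) ≡ 𝟙 (n ≟ length ν) * ℕtoℚ (n !)

  words-starting-with : ∀ N n x ν → PartsIn N ν → (∀ ρ → PartsIn N ρ → WordCount N n ρ) →
    Σ (words N n) (λ w → 𝟙 ((x ∷ w) ≈ₘ? ν)) * ℕtoℚ (multFactorials ν) ≡ ℕtoℚ (mult x ν) * (𝟙 (suc n ≟ length ν) * ℕtoℚ (n !))
  words-starting-with N n x ν ν-in count with x ∈? ν
  ... | no x∉ν = trans (cong (_* ℕtoℚ (multFactorials ν))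
                         (Σ-zero-∀ (words N n) (λ w → 𝟙-no ((x ∷ w) ≈ₘ? ν) (λ e → x∉ν (↭P.∈-resp-↭ (≈ₘ⇒↭ {x ∷ w} {ν} e) (here refl))))))
                       (trans (ℚP.*-zeroˡ (ℕtoℚ (multFactorials ν))) (sym (trans (cong (λ u → ℕtoℚ u * C) (mult-∉ x ν x∉ν)) (ℚP.*-zeroˡ C))))
    where
    C = 𝟙 (suc n ≟ length ν) * ℕtoℚ (n !)
  ... | yes x∈ν with ∈-∃++ x∈ν
  ... | ys , zs , ν≡ys++x∷zs = begin
    Σ (words N n) (λ w → 𝟙 ((x ∷ w) ≈ₘ? ν)) * ℕtoℚ (multFactorials ν)
      ≡⟨ cong₂ _*_ (Σ-cong (words N n) (λ w → 𝟙-⇔ ((x ∷ w) ≈ₘ? ν) (w ≈ₘ? rest)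
             (λ e → ↭⇒≈ₘ (↭P.drop-∷ (↭-trans (≈ₘ⇒↭ {x ∷ w} {ν} e) ν↭x∷rest)))
             (λ e → ↭⇒≈ₘ (↭-trans (↭.prep x (≈ₘ⇒↭ {w} {rest} e)) (↭-sym ν↭x∷rest)))))
           (trans (cong ℕtoℚ (multFactorials-↭ ν↭x∷rest)) (ℕtoℚ-* (suc (mult x rest)) (multFactorials rest))) ⟩
    Σ (words N n) (λ w → 𝟙 (w ≈ₘ? rest)) * (ℕtoℚ (suc (mult x rest)) * ℕtoℚ (multFactorials rest))
      ≡⟨ ℚ*.x∙yz≈y∙xz (Σ (words N n) (λ w → 𝟙 (w ≈ₘ? rest))) (ℕtoℚ (suc (mult x rest))) (ℕtoℚ (multFactorials rest)) ⟩
    ℕtoℚ (suc (mult x rest)) * (Σ (words N n) (λ w → 𝟙 (w ≈ₘ? rest)) * ℕtoℚ (multFactorials rest))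
      ≡⟨ cong₂ _*_ (cong ℕtoℚ (sym (trans (mult-↭ x ν↭x∷rest) (mult-∷-≡ x rest)))) (count rest rest-in) ⟩
    ℕtoℚ (mult x ν) * (𝟙 (n ≟ length rest) * ℕtoℚ (n !))
      ≡⟨ cong (λ u → ℕtoℚ (mult x ν) * (u * ℕtoℚ (n !))) (𝟙-⇔ (n ≟ length rest) (suc n ≟ length ν)
            (λ e → trans (cong suc e) (sym (↭P.↭-length ν↭x∷rest))) (λ e → ℕP.suc-injective (trans e (↭P.↭-length ν↭x∷rest)))) ⟩
    ℕtoℚ (mult x ν) * (𝟙 (suc n ≟ length ν) * ℕtoℚ (n !)) ∎
    where
    rest = ys ++ zs
    ν↭x∷rest : ν ↭ x ∷ rest
    ν↭x∷rest = ↭-trans (↭-reflexive ν≡ys++x∷zs) (↭P.shift x ys zs)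
    rest-in : PartsIn N rest
    rest-in = All.tail (↭P.All-resp-↭ ν↭x∷rest ν-in)

  count-words : ∀ N n ν → PartsIn N ν → WordCount N n ν
  count-words N zero [] [] = refl
  count-words N zero (x ∷ ν) _ = trans (cong (λ u → (u + 0ℚ) * ℕtoℚ (multFactorials (x ∷ ν)))
      (𝟙-no ([] ≈ₘ? (x ∷ ν)) (λ e → ℕP.0≢1+n (↭P.↭-length (≈ₘ⇒↭ {[]} {x ∷ ν} e)))))
    (trans (ℚP.*-zeroˡ (ℕtoℚ (multFactorials (x ∷ ν)))) (sym (ℚP.*-zeroˡ (ℕtoℚ 1))))
  count-words N (suc n) ν ν-in = begin
    Σ (words N (suc n)) (λ w → 𝟙 (w ≈ₘ? ν)) * ℕtoℚ (multFactorials ν)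
      ≡⟨ cong (_* ℕtoℚ (multFactorials ν)) (Σ-concatMap (λ k → map (k ∷_) (words N n)) (range1 N) (λ w → 𝟙 (w ≈ₘ? ν))) ⟩
    Σ (range1 N) (λ x → Σ (map (x ∷_) (words N n)) (λ w → 𝟙 (w ≈ₘ? ν))) * ℕtoℚ (multFactorials ν)
      ≡⟨ *-distribʳ-Σ (ℕtoℚ (multFactorials ν)) (range1 N) _ ⟩
    Σ (range1 N) (λ x → Σ (map (x ∷_) (words N n)) (λ w → 𝟙 (w ≈ₘ? ν)) * ℕtoℚ (multFactorials ν))
      ≡⟨ Σ-cong (range1 N) (λ x → trans (cong (_* ℕtoℚ (multFactorials ν)) (Σ-map (x ∷_) (words N n) (λ w → 𝟙 (w ≈ₘ? ν))))
                                         (words-starting-with N n x ν ν-in (count-words N n))) ⟩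
    Σ (range1 N) (λ x → ℕtoℚ (mult x ν) * C)
      ≡⟨ *-distribʳ-Σ C (range1 N) _ ⟨
    Σ (range1 N) (λ x → ℕtoℚ (mult x ν)) * C
      ≡⟨ cong (_* C) (Σ-mult≡length N ν ν-in) ⟩
    ℕtoℚ (length ν) * C
      ≡⟨ length*C (suc n ≟ length ν) ⟩
    𝟙 (suc n ≟ length ν) * ℕtoℚ (suc n !) ∎
    where
    C = 𝟙 (suc n ≟ length ν) * ℕtoℚ (n !)
    length*C : (d : Dec (suc n ≡ length ν)) → ℕtoℚ (length ν) * (𝟙 d * ℕtoℚ (n !)) ≡ 𝟙 d * ℕtoℚ (suc n !)
    length*C d@(yes e) = trans (cong (λ u → ℕtoℚ u * (𝟙 d * ℕtoℚ (n !))) (sym e))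
      (trans (ℚ*.x∙yz≈y∙xz (ℕtoℚ (suc n)) (𝟙 d) (ℕtoℚ (n !))) (cong (𝟙 d *_) (sym (ℕtoℚ-* (suc n) (n !)))))
    length*C d@(no _) = trans (cong (ℕtoℚ (length ν) *_) (ℚP.*-zeroˡ (ℕtoℚ (n !))))
      (trans (ℚP.*-zeroʳ (ℕtoℚ (length ν))) (sym (ℚP.*-zeroˡ (ℕtoℚ (suc n !)))))

  length≤sum : ∀ ν → All (0 <_) ν → length ν ≤ sum ν
  length≤sum [] [] = z≤n
  length≤sum (x ∷ ν) (x>0 ∷ pos) = ℕP.+-mono-≤ x>0 (length≤sum ν pos)

  coeff-expLogΩ : ∀ N ν → All (0 <_) ν → sum ν ≤ N → coeff ν (expLogΩ N) ≡ inv (z ν)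
  coeff-expLogΩ N ν pos ν≤N = begin
    coeff ν (expLogΩ N)
      ≡⟨ coeff-concatMap ν (λ n → scale (inv (n !)) (prodS (replicate n (logΩ N)))) (upTo (suc N)) ⟩
    Σ (upTo (suc N)) (λ n → coeff ν (scale (inv (n !)) (prodS (replicate n (logΩ N)))))
      ≡⟨ Σ-cong (upTo (suc N)) (λ n → trans (coeff-scale ν (inv (n !)) (prodS (replicate n (logΩ N))))
            (trans (cong (inv (n !) *_) (coeff-logΩ-power N n ν)) (term n))) ⟩
    Σ (upTo (suc N)) (λ n → 𝟙 (n ≟ length ν) * (inv (multFactorials ν) * prodℚ (map inv ν)))
      ≡⟨ cong (λ l → Σ l (λ n → 𝟙 (n ≟ length ν) * (inv (multFactorials ν) * prodℚ (map inv ν)))) (upTo≡interval (suc N)) ⟩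
    Σ (interval 0 (suc N)) (λ n → 𝟙 (n ≟ length ν) * (inv (multFactorials ν) * prodℚ (map inv ν)))
      ≡⟨ Σ-interval-δ 0 (suc N) (length ν) _ z≤n (s≤s (ℕP.≤-trans (length≤sum ν pos) ν≤N)) ⟩
    inv (multFactorials ν) * prodℚ (map inv ν)
      ≡⟨ cong (inv (multFactorials ν) *_) (prodℚ-map-inv ν) ⟩
    inv (multFactorials ν) * inv (product ν)
      ≡⟨ inv-* (multFactorials ν) (product ν) ⟨
    inv (multFactorials ν ℕ.* product ν)
      ≡⟨ cong inv (z≡multFactorials*product ν pos) ⟨
    inv (z ν) ∎
    where
    term : ∀ n → inv (n !) * (Σ (words N n) (λ w → 𝟙 (w ≈ₘ? ν)) * prodℚ (map inv ν)) ≡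
                 𝟙 (n ≟ length ν) * (inv (multFactorials ν) * prodℚ (map inv ν))
    term n = begin
      inv (n !) * (Σ (words N n) (λ w → 𝟙 (w ≈ₘ? ν)) * prodℚ (map inv ν))
        ≡⟨ cong (λ u → inv (n !) * (u * prodℚ (map inv ν)))
             (*ℕtoℚ≡⇒≡*inv (Σ (words N n) (λ w → 𝟙 (w ≈ₘ? ν))) (𝟙 (n ≟ length ν) * ℕtoℚ (n !)) (multFactorials-positive ν) (count-words N n ν (partsIn-≤ ν pos ν≤N))) ⟩
      inv (n !) * (((𝟙 (n ≟ length ν) * ℕtoℚ (n !)) * inv (multFactorials ν)) * prodℚ (map inv ν))
        ≡⟨ rearrange (inv (n !)) (𝟙 (n ≟ length ν)) (ℕtoℚ (n !)) (inv (multFactorials ν)) (prodℚ (map inv ν)) ⟩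
      𝟙 (n ≟ length ν) * ((inv (n !) * ℕtoℚ (n !)) * (inv (multFactorials ν) * prodℚ (map inv ν)))
        ≡⟨ cong (λ u → 𝟙 (n ≟ length ν) * (u * (inv (multFactorials ν) * prodℚ (map inv ν)))) (inv*ℕtoℚ≡1 (ℕP.1≤n! n)) ⟩
      𝟙 (n ≟ length ν) * (1ℚ * (inv (multFactorials ν) * prodℚ (map inv ν)))
        ≡⟨ cong (𝟙 (n ≟ length ν) *_) (ℚP.*-identityˡ _) ⟩
      𝟙 (n ≟ length ν) * (inv (multFactorials ν) * prodℚ (map inv ν)) ∎
      where
      rearrange : ∀ u i F g P → u * (((i * F) * g) * P) ≡ i * ((u * F) * (g * P))
      rearrange = solve 5 (λ u i F g P → u ⊗ₑ (((i ⊗ₑ F) ⊗ₑ g) ⊗ₑ P) ⊜ i ⊗ₑ ((u ⊗ₑ F) ⊗ₑ (g ⊗ₑ P))) refl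
        where open ℚ-Solver

  coeff-ΩUpTo : ∀ N ν → All (0 <_) ν → sum ν ≤ N → coeff ν (ΩUpTo N) ≡ inv (z ν)
  coeff-ΩUpTo N ν pos ν≤N = begin
    coeff ν (ΩUpTo N) ≡⟨ coeff-concatMap ν h (upTo (suc N)) ⟩
    Σ (upTo (suc N)) (λ k → coeff ν (h k))
      ≡⟨ Σ-cong (upTo (suc N)) (λ k → trans (coeff-h k ν pos) (cong (_* inv (z ν)) (𝟙-⇔ (sum ν ≟ k) (k ≟ sum ν) sym sym))) ⟩
    Σ (upTo (suc N)) (λ k → 𝟙 (k ≟ sum ν) * inv (z ν))
      ≡⟨ cong (λ l → Σ l (λ k → 𝟙 (k ≟ sum ν) * inv (z ν))) (upTo≡interval (suc N)) ⟩
    Σ (interval 0 (suc N)) (λ k → 𝟙 (k ≟ sum ν) * inv (z ν))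
      ≡⟨ Σ-interval-δ 0 (suc N) (sum ν) (λ _ → inv (z ν)) z≤n (s≤s ν≤N) ⟩
    inv (z ν) ∎

  Positive-ΩUpTo : ∀ N → Positive (ΩUpTo N)
  Positive-ΩUpTo N = Positive-Σh (upTo (suc N))

  coeff-Ω-pleth : ∀ la → All (0 <_) la → la ≢ [] → ∀ A → Positive A → MinDegree 1 A →
                  coeff la (pleth (ΩUpTo (sum la)) A) ≡
                  Σ (range1 (sum la)) (λ n → inv (n !) * coeff la (prodS (replicate n (pleth (logΩ (sum la)) A))))
  coeff-Ω-pleth la pos la≢[] A A-pos A≥1 = begin
    coeff la (pleth (ΩUpTo N) A)
      ≡⟨ coeff-pleth N la ℕP.≤-refl (ΩUpTo N) A (Positive-ΩUpTo N) A-pos A≥1 ⟩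
    Σ (partitionsUpTo N) (λ ν → coeff ν (ΩUpTo N) * coeff la (pν ν A))
      ≡⟨ Σ-cong-All (All.zipWith (λ { {ν} ((ν-pos , _) , ν≤N) → cong (_* coeff la (pν ν A))
           (trans (coeff-ΩUpTo N ν ν-pos ν≤N) (sym (coeff-expLogΩ N ν ν-pos ν≤N))) })
           (partitionsUpTo-isPartition N , partitionsUpTo-sum≤ N)) ⟩
    Σ (partitionsUpTo N) (λ ν → coeff ν (expLogΩ N) * coeff la (pν ν A))
      ≡⟨ coeff-pleth N la ℕP.≤-refl (expLogΩ N) A (Positive-expLogΩ N) A-pos A≥1 ⟨
    coeff la (pleth (expLogΩ N) A)
      ≡⟨ coeff-pleth-concatMap la (λ n → scale (inv (n !)) (prodS (replicate n (logΩ N)))) (upTo (suc N)) A ⟩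
    Σ (upTo (suc N)) (λ n → coeff la (pleth (scale (inv (n !)) (prodS (replicate n (logΩ N)))) A))
      ≡⟨ Σ-cong (upTo (suc N)) (λ n → trans (coeff-pleth-scale la (inv (n !)) (prodS (replicate n (logΩ N))) A)
            (cong (inv (n !) *_) (pleth-power (logΩ N) A n (Positive-logΩ N) A-pos la))) ⟩
    Σ (upTo (suc N)) (λ n → inv (n !) * coeff la (prodS (replicate n (pleth (logΩ N) A))))
      ≡⟨ cong (λ l → Σ l (λ n → inv (n !) * coeff la (prodS (replicate n (pleth (logΩ N) A))))) (upTo-suc N) ⟩
    inv 1 * coeff la oneS + Σ (range1 N) (λ n → inv (n !) * coeff la (prodS (replicate n (pleth (logΩ N) A))))
      ≡⟨ cong (λ c → inv 1 * c + Σ (range1 N) (λ n → inv (n !) * coeff la (prodS (replicate n (pleth (logΩ N) A))))) (coeff-oneS la la≢[]) ⟩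
    0ℚ + Σ (range1 N) (λ n → inv (n !) * coeff la (prodS (replicate n (pleth (logΩ N) A))))
      ≡⟨ ℚP.+-identityˡ _ ⟩
    Σ (range1 N) (λ n → inv (n !) * coeff la (prodS (replicate n (pleth (logΩ N) A)))) ∎
    where
    N = sum la
    open PartitionEnumeration using (partitionsUpTo; partitionsUpTo-isPartition; partitionsUpTo-sum≤)

module Tuples where

  open FiniteSums
  open Intervals
  open PartitionEnumeration
  open Coefficients
  open SeriesInvariants using (Positive-prodS)
  open CoefficientAlgebra using (coeff-oneS)

  tuples-valid : ∀ n N → All (λ μs → All IsPartition μs × sum (concat μs) ≡ N) (tuples n N)
  tuples-valid zero zero = ([] , refl) ∷ []
  tuples-valid zero (suc N) = []
  tuples-valid (suc n) N = All-concatMap _ (All.map (λ { {a} (_ , a≤N) →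
    All-concatMap _ (All.zipWith (λ { {μ} (μ-part , μ-sum) →
      AllP.map⁺ (All.map (λ { {rest} (rest-part , rest-sum) → (μ-part ∷ rest-part) ,
        trans (sum-++ μ (concat rest)) (trans (cong₂ ℕ._+_ μ-sum rest-sum) (ℕP.m+[n∸m]≡n a≤N)) }) (tuples-valid n (N ∸ a))) })
      (partitions-isPartition a , partitions-sum a)) }) (range1-bounds N))

  module _ (c : List ℕ → ℚ) where

    Πc : List (List ℕ) → ℚ
    Πc μs = prodℚ (map c μs)

    TupleExpansion : ℕ → (List ℕ → ℚ) → Set
    TupleExpansion n d = ∀ σ → All (0 <_) σ → d σ ≡ Σ (tuples n (sum σ)) (λ rest → 𝟙 (concat rest ≈ₘ? σ) * Πc rest)

    Σ-partitionsUpTo-tuples : ∀ n d → TupleExpansion n d → ∀ la ρ → sum ρ ≤ sum la →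
      Σ (partitionsUpTo (sum la)) (λ σ → 𝟙 ((ρ ++ σ) ≈ₘ? la) * d σ) ≡
      Σ (tuples n (sum la ∸ sum ρ)) (λ rest → 𝟙 ((ρ ++ concat rest) ≈ₘ? la) * Πc rest)
    Σ-partitionsUpTo-tuples n d d-exp la ρ ρ≤la = begin
      Σ (partitionsUpTo N) (λ σ → 𝟙 ((ρ ++ σ) ≈ₘ? la) * d σ)
        ≡⟨ Σ-concatMap partitions (upTo (suc N)) (λ σ → 𝟙 ((ρ ++ σ) ≈ₘ? la) * d σ) ⟩
      Σ (upTo (suc N)) (λ b → Σ (partitions b) (λ σ → 𝟙 ((ρ ++ σ) ≈ₘ? la) * d σ))
        ≡⟨ Σ-cong (upTo (suc N)) (λ b → Σ-cong-All (All.zipWith (λ { {σ} ((σ-pos , _) , σ-sum) →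
             cong (𝟙 ((ρ ++ σ) ≈ₘ? la) *_) (trans (d-exp σ σ-pos) (cong (λ s → Σ (tuples n s) (λ rest → 𝟙 (concat rest ≈ₘ? σ) * Πc rest)) σ-sum)) })
             (partitions-isPartition b , partitions-sum b))) ⟩
      Σ (upTo (suc N)) (λ b → Σ (partitions b) (λ σ → 𝟙 ((ρ ++ σ) ≈ₘ? la) * Σ (tuples n b) (λ rest → 𝟙 (concat rest ≈ₘ? σ) * Πc rest)))
        ≡⟨ Σ-cong (upTo (suc N)) (λ b → trans
             (Σ-cong (partitions b) (λ σ → *-distribˡ-Σ (𝟙 ((ρ ++ σ) ≈ₘ? la)) (tuples n b) (λ rest → 𝟙 (concat rest ≈ₘ? σ) * Πc rest)))
             (Σ-comm (partitions b) (tuples n b) (λ σ rest → 𝟙 ((ρ ++ σ) ≈ₘ? la) * (𝟙 (concat rest ≈ₘ? σ) * Πc rest)))) ⟩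
      Σ (upTo (suc N)) (λ b → Σ (tuples n b) (λ rest → Σ (partitions b) (λ σ → 𝟙 ((ρ ++ σ) ≈ₘ? la) * (𝟙 (concat rest ≈ₘ? σ) * Πc rest))))
        ≡⟨ Σ-cong (upTo (suc N)) (λ b → Σ-cong-All (All.map (λ { {rest} (rest-part , rest-sum) → collapse b rest rest-part rest-sum }) (tuples-valid n b))) ⟩
      Σ (upTo (suc N)) (λ b → Σ (tuples n b) (λ rest → 𝟙 ((ρ ++ concat rest) ≈ₘ? la) * Πc rest))
        ≡⟨ cong (λ l → Σ l (λ b → Σ (tuples n b) (λ rest → 𝟙 ((ρ ++ concat rest) ≈ₘ? la) * Πc rest))) (upTo≡interval (suc N)) ⟩
      Σ (interval 0 (suc N)) (λ b → Σ (tuples n b) (λ rest → 𝟙 ((ρ ++ concat rest) ≈ₘ? la) * Πc rest))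
        ≡⟨ Σ-interval-single 0 (suc N) (N ∸ sum ρ) _ z≤n (s≤s (ℕP.m∸n≤m N (sum ρ))) (λ b b≢ →
             Σ-zero (All.map (λ { {rest} (_ , rest-sum) → 𝟙-no-* ((ρ ++ concat rest) ≈ₘ? la) (λ e → b≢ (size b rest rest-sum e)) }) (tuples-valid n b))) ⟩
      Σ (tuples n (N ∸ sum ρ)) (λ rest → 𝟙 ((ρ ++ concat rest) ≈ₘ? la) * Πc rest) ∎
      where
      N = sum la
      collapse : ∀ b rest → All IsPartition rest → sum (concat rest) ≡ b →
                 Σ (partitions b) (λ σ → 𝟙 ((ρ ++ σ) ≈ₘ? la) * (𝟙 (concat rest ≈ₘ? σ) * Πc rest)) ≡ 𝟙 ((ρ ++ concat rest) ≈ₘ? la) * Πc rest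
      collapse b rest rest-part rest-sum = begin
        Σ (partitions b) (λ σ → 𝟙 ((ρ ++ σ) ≈ₘ? la) * (𝟙 (concat rest ≈ₘ? σ) * Πc rest))
          ≡⟨ Σ-cong (partitions b) (λ σ → ℚ*.x∙yz≈z∙yx (𝟙 ((ρ ++ σ) ≈ₘ? la)) (𝟙 (concat rest ≈ₘ? σ)) (Πc rest)) ⟩
        Σ (partitions b) (λ σ → Πc rest * (𝟙 (concat rest ≈ₘ? σ) * 𝟙 ((ρ ++ σ) ≈ₘ? la)))
          ≡⟨ *-distribˡ-Σ (Πc rest) (partitions b) _ ⟨
        Πc rest * Σ (partitions b) (λ σ → 𝟙 (concat rest ≈ₘ? σ) * 𝟙 ((ρ ++ σ) ≈ₘ? la))
          ≡⟨ cong (Πc rest *_) (Σ-partitions-δ b (concat rest) (AllP.concat⁺ (All.map proj₁ rest-part)) (λ σ → 𝟙 ((ρ ++ σ) ≈ₘ? la))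
                                  (λ _ p → 𝟙≈ₘ-respˡ la (↭P.++⁺ˡ ρ p))) ⟩
        Πc rest * (𝟙 (sum (concat rest) ≟ b) * 𝟙 ((ρ ++ concat rest) ≈ₘ? la))
          ≡⟨ cong (Πc rest *_) (𝟙-yes-* (sum (concat rest) ≟ b) rest-sum) ⟩
        Πc rest * 𝟙 ((ρ ++ concat rest) ≈ₘ? la)
          ≡⟨ ℚP.*-comm (Πc rest) _ ⟩
        𝟙 ((ρ ++ concat rest) ≈ₘ? la) * Πc rest ∎
      size : ∀ b rest → sum (concat rest) ≡ b → (ρ ++ concat rest) ≈ₘ la → b ≡ N ∸ sum ρ
      size b rest rest-sum e = begin
        b                                    ≡⟨ ℕP.m+n∸m≡n (sum ρ) b ⟨
        sum ρ ℕ.+ b ∸ sum ρ                  ≡⟨ cong (λ u → sum ρ ℕ.+ u ∸ sum ρ) rest-sum ⟨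
        sum ρ ℕ.+ sum (concat rest) ∸ sum ρ  ≡⟨ cong (_∸ sum ρ) (sum-++ ρ (concat rest)) ⟨
        sum (ρ ++ concat rest) ∸ sum ρ       ≡⟨ cong (_∸ sum ρ) (Multisets.≈ₘ-sum {ρ ++ concat rest} {la} e) ⟩
        N ∸ sum ρ                            ∎

  module _ (L : Sym) (L-pos : Positive L) (L≥1 : MinDegree 1 L) where

    private
      c = λ μ → coeff μ L
      Lⁿ-pos : ∀ n → Positive (prodS (replicate n L))
      Lⁿ-pos n = Positive-prodS (replicate n L) (AllP.replicate⁺ n L-pos)

    coeff-power : ∀ n → TupleExpansion c n (λ la → coeff la (prodS (replicate n L)))
    coeff-power zero [] [] = coeff-Σ [] oneS
    coeff-power zero (zero ∷ la) (() ∷ _)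
    coeff-power zero (suc x ∷ la) _ = coeff-oneS (suc x ∷ la) (λ ())
    coeff-power (suc n) la pos = begin
      coeff la (L ⊗ Lⁿ)
        ≡⟨ coeff-⊗ N la ℕP.≤-refl L Lⁿ L-pos (Lⁿ-pos n) ⟩
      Σ (partitionsUpTo N) (λ ρ → Σ (partitionsUpTo N) (λ σ → 𝟙 ((ρ ++ σ) ≈ₘ? la) * (c ρ * coeff σ Lⁿ)))
        ≡⟨ Σ-cong-All (All.map (λ {ρ} ρ≤N → first-block ρ ρ≤N) (partitionsUpTo-sum≤ N)) ⟩
      Σ (partitionsUpTo N) G
        ≡⟨ Σ-concatMap partitions (upTo (suc N)) G ⟩
      Σ (upTo (suc N)) (λ a → Σ (partitions a) G)
        ≡⟨ cong (λ l → Σ l (λ a → Σ (partitions a) G)) (upTo-suc N) ⟩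
      (G [] + 0ℚ) + Σ (range1 N) (λ a → Σ (partitions a) G)
        ≡⟨ cong (_+ Σ (range1 N) (λ a → Σ (partitions a) G)) (trans (ℚP.+-identityʳ (G [])) G[]≡0) ⟩
      0ℚ + Σ (range1 N) (λ a → Σ (partitions a) G)
        ≡⟨ ℚP.+-identityˡ _ ⟩
      Σ (range1 N) (λ a → Σ (partitions a) G)
        ≡⟨ Σ-cong (range1 N) (λ a → trans (Σ-cong-All (All.map (λ {ρ} ρ-sum → cong (λ s → Σ (tuples n (N ∸ s)) (F ρ)) ρ-sum) (partitions-sum a)))
                                          (sym (trans (Σ-concatMap (λ μ → map (μ ∷_) (tuples n (N ∸ a))) (partitions a) H)
                                                      (Σ-cong (partitions a) (λ μ → Σ-map (μ ∷_) (tuples n (N ∸ a)) H))))) ⟩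
      Σ (range1 N) (λ a → Σ (concatMap (λ μ → map (μ ∷_) (tuples n (N ∸ a))) (partitions a)) H)
        ≡⟨ Σ-concatMap (λ a → concatMap (λ μ → map (μ ∷_) (tuples n (N ∸ a))) (partitions a)) (range1 N) H ⟨
      Σ (tuples (suc n) N) H ∎
      where
      N = sum la
      Lⁿ = prodS (replicate n L)
      F : List ℕ → List (List ℕ) → ℚ
      F ρ rest = 𝟙 ((ρ ++ concat rest) ≈ₘ? la) * (c ρ * Πc c rest)
      G : List ℕ → ℚ
      G ρ = Σ (tuples n (N ∸ sum ρ)) (F ρ)
      H : List (List ℕ) → ℚ
      H μs = 𝟙 (concat μs ≈ₘ? la) * Πc c μs
      G[]≡0 : G [] ≡ 0ℚ
      G[]≡0 = Σ-zero-∀ (tuples n N) (λ rest → trans (cong (λ u → 𝟙 (concat rest ≈ₘ? la) * (u * Πc c rest))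
                (coeff-below-MinDegree 1 L [] L≥1 (s≤s z≤n))) (trans (cong (𝟙 (concat rest ≈ₘ? la) *_) (ℚP.*-zeroˡ (Πc c rest))) (ℚP.*-zeroʳ (𝟙 (concat rest ≈ₘ? la)))))
      first-block : ∀ ρ → sum ρ ≤ N → Σ (partitionsUpTo N) (λ σ → 𝟙 ((ρ ++ σ) ≈ₘ? la) * (c ρ * coeff σ Lⁿ)) ≡ G ρ
      first-block ρ ρ≤N = begin
        Σ (partitionsUpTo N) (λ σ → 𝟙 ((ρ ++ σ) ≈ₘ? la) * (c ρ * coeff σ Lⁿ))
          ≡⟨ Σ-cong (partitionsUpTo N) (λ σ → ℚ*.x∙yz≈y∙xz (𝟙 ((ρ ++ σ) ≈ₘ? la)) (c ρ) (coeff σ Lⁿ)) ⟩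
        Σ (partitionsUpTo N) (λ σ → c ρ * (𝟙 ((ρ ++ σ) ≈ₘ? la) * coeff σ Lⁿ))
          ≡⟨ *-distribˡ-Σ (c ρ) (partitionsUpTo N) _ ⟨
        c ρ * Σ (partitionsUpTo N) (λ σ → 𝟙 ((ρ ++ σ) ≈ₘ? la) * coeff σ Lⁿ)
          ≡⟨ cong (c ρ *_) (Σ-partitionsUpTo-tuples c n (λ σ → coeff σ Lⁿ) (coeff-power n) la ρ ρ≤N) ⟩
        c ρ * Σ (tuples n (N ∸ sum ρ)) (λ rest → 𝟙 ((ρ ++ concat rest) ≈ₘ? la) * Πc c rest)
          ≡⟨ *-distribˡ-Σ (c ρ) (tuples n (N ∸ sum ρ)) _ ⟩
        Σ (tuples n (N ∸ sum ρ)) (λ rest → c ρ * (𝟙 ((ρ ++ concat rest) ≈ₘ? la) * Πc c rest))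
          ≡⟨ Σ-cong (tuples n (N ∸ sum ρ)) (λ rest → ℚ*.x∙yz≈y∙xz (c ρ) (𝟙 ((ρ ++ concat rest) ≈ₘ? la)) (Πc c rest)) ⟩
        G ρ ∎

module DegreeTruncation where

  open FiniteSums
  open Intervals
  open Multisets
  open PartitionEnumeration
  open Coefficients
  open SeriesInvariants
  open CoefficientAlgebra
  open ExponentialFormula using (coeff-ΩUpTo; Positive-ΩUpTo)
  open import Data.Nat.Divisibility using (_∣?_)
  open import Data.Nat.DivMod using (m/n≤m)

  coeff-nonpositive : ∀ P ρ → Positive P → ¬ All (0 <_) ρ → coeff ρ P ≡ 0ℚ
  coeff-nonpositive P ρ P-pos ρ-nonpos = trans (coeff-Σ ρ P) (Σ-zero (All.map (λ {t} t-pos →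
    𝟙-no-* (proj₁ t ≈ₘ? ρ) (λ e → ρ-nonpos (↭P.All-resp-↭ (≈ₘ⇒↭ {proj₁ t} {ρ} e) t-pos))) P-pos))

  ≈[≤]-positive : ∀ K {P Q} → Positive P → Positive Q → (∀ ρ → All (0 <_) ρ → sum ρ ≤ K → coeff ρ P ≡ coeff ρ Q) → P ≈[≤ K ] Q
  ≈[≤]-positive K {P} {Q} P-pos Q-pos agree ρ ρ≤K with all? (0 <?_) ρ
  ... | yes ρ-pos = agree ρ ρ-pos ρ≤K
  ... | no ρ-nonpos = trans (coeff-nonpositive P ρ P-pos ρ-nonpos) (sym (coeff-nonpositive Q ρ Q-pos ρ-nonpos))

  coeff-trunc-≤ : ∀ N P la → sum la ≤ N → coeff la (trunc N P) ≡ coeff la P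
  coeff-trunc-≤ N P la la≤N = trans (coeff-trunc N P la) (𝟙-yes-* (sum la ≤? N) la≤N)

  sum-map-/≤ : ∀ k-1 σ → sum (map (λ x → x ℕ./ suc k-1) σ) ≤ sum σ
  sum-map-/≤ k-1 [] = z≤n
  sum-map-/≤ k-1 (x ∷ σ) = ℕP.+-mono-≤ (m/n≤m x (suc k-1)) (sum-map-/≤ k-1 σ)

  pk-cong≤ : ∀ K k {A A'} → 0 < k → A ≈[≤ K ] A' → pk k A ≈[≤ K ] pk k A'
  pk-cong≤ K (suc k-1) {A} {A'} _ A≈A' ρ ρ≤K = trans (coeff-pk k-1 ρ A) (trans
    (cong (𝟙 (all? (suc k-1 ∣?_) ρ) *_) (A≈A' (map (λ x → x ℕ./ suc k-1) ρ) (ℕP.≤-trans (sum-map-/≤ k-1 ρ) ρ≤K)))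
    (sym (coeff-pk k-1 ρ A')))

  pν-cong≤ : ∀ K {A A'} → Positive A → Positive A' → A ≈[≤ K ] A' → ∀ ν → All (0 <_) ν → pν ν A ≈[≤ K ] pν ν A'
  pν-cong≤ K A-pos A'-pos A≈A' [] [] ρ ρ≤K = refl
  pν-cong≤ K {A} {A'} A-pos A'-pos A≈A' (k ∷ ν) (k>0 ∷ ν-pos) =
    ⊗-cong≤ K (Positive-pk k A k>0 A-pos) (Positive-pk k A' k>0 A'-pos) (Positive-pν A ν ν-pos A-pos) (Positive-pν A' ν ν-pos A'-pos)
      (pk-cong≤ K k {A} {A'} k>0 A≈A') (pν-cong≤ K A-pos A'-pos A≈A' ν ν-pos)

  pleth-cong≤ : ∀ K {X X' A A'} → Positive X → Positive X' → Positive A → Positive A' → MinDegree 1 A → MinDegree 1 A' →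
                X ≈[≤ K ] X' → A ≈[≤ K ] A' → pleth X A ≈[≤ K ] pleth X' A'
  pleth-cong≤ K {X} {X'} {A} {A'} X-pos X'-pos A-pos A'-pos A≥1 A'≥1 X≈X' A≈A' ρ ρ≤K = begin
    coeff ρ (pleth X A) ≡⟨ coeff-pleth K ρ ρ≤K X A X-pos A-pos A≥1 ⟩
    Σ (partitionsUpTo K) (λ ν → coeff ν X * coeff ρ (pν ν A))
      ≡⟨ Σ-cong-All (All.zipWith (λ { {ν} ((ν-pos , _) , ν≤K) → cong₂ _*_ (X≈X' ν ν≤K) (pν-cong≤ K A-pos A'-pos A≈A' ν ν-pos ρ ρ≤K) })
                                 (partitionsUpTo-isPartition K , partitionsUpTo-sum≤ K)) ⟩
    Σ (partitionsUpTo K) (λ ν → coeff ν X' * coeff ρ (pν ν A')) ≡⟨ coeff-pleth K ρ ρ≤K X' A' X'-pos A'-pos A'≥1 ⟨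
    coeff ρ (pleth X' A') ∎

  coeff-Ω₀UpTo : ∀ M ν → All (0 <_) ν → sum ν ≤ M → coeff ν (Ω₀UpTo M) ≡ 𝟙 (1 ≤? sum ν) * inv (z ν)
  coeff-Ω₀UpTo M ν pos ν≤M = begin
    coeff ν (Ω₀UpTo M) ≡⟨ coeff-concatMap ν h (range1 M) ⟩
    Σ (range1 M) (λ k → coeff ν (h k))
      ≡⟨ Σ-cong (range1 M) (λ k → trans (coeff-h k ν pos) (cong (_* inv (z ν)) (𝟙-⇔ (sum ν ≟ k) (k ≟ sum ν) sym sym))) ⟩
    Σ (range1 M) (λ k → 𝟙 (k ≟ sum ν) * inv (z ν))
      ≡⟨ cong (λ l → Σ l (λ k → 𝟙 (k ≟ sum ν) * inv (z ν))) (range1≡interval M) ⟩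
    Σ (interval 1 M) (λ k → 𝟙 (k ≟ sum ν) * inv (z ν))
      ≡⟨ select (1 ≤? sum ν) ⟩
    𝟙 (1 ≤? sum ν) * inv (z ν) ∎
    where
    select : (d : Dec (1 ≤ sum ν)) → Σ (interval 1 M) (λ k → 𝟙 (k ≟ sum ν) * inv (z ν)) ≡ 𝟙 d * inv (z ν)
    select d@(yes 1≤ν) = trans (Σ-interval-δ 1 M (sum ν) (λ _ → inv (z ν)) 1≤ν (s≤s ν≤M)) (sym (𝟙-yes-* d {inv (z ν)} 1≤ν))
    select d@(no 1≰ν) = trans (Σ-interval-δ-outside 1 M (sum ν) (λ _ → inv (z ν)) (λ { (1≤ν , _) → 1≰ν 1≤ν })) (sym (𝟙-no-* d {inv (z ν)} 1≰ν))

  Ω₀UpTo-cong≤ : ∀ K N → K ≤ N → Ω₀UpTo K ≈[≤ K ] Ω₀UpTo N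
  Ω₀UpTo-cong≤ K N K≤N = ≈[≤]-positive K (Positive-Σh (range1 K)) (Positive-Σh (range1 N)) (λ ρ ρ-pos ρ≤K →
    trans (coeff-Ω₀UpTo K ρ ρ-pos ρ≤K) (sym (coeff-Ω₀UpTo N ρ ρ-pos (ℕP.≤-trans ρ≤K K≤N))))

  ΩUpTo-cong≤ : ∀ K N → K ≤ N → ΩUpTo K ≈[≤ K ] ΩUpTo N
  ΩUpTo-cong≤ K N K≤N = ≈[≤]-positive K (Positive-ΩUpTo K) (Positive-ΩUpTo N) (λ ρ ρ-pos ρ≤K →
    trans (coeff-ΩUpTo K ρ ρ-pos ρ≤K) (sym (coeff-ΩUpTo N ρ ρ-pos (ℕP.≤-trans ρ≤K K≤N))))

  Ω₀iter-cong≤ : ∀ m K N → K ≤ N → Ω₀iter m K ≈[≤ K ] Ω₀iter m N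
  Ω₀iter-cong≤ zero K N K≤N ρ ρ≤K = refl
  Ω₀iter-cong≤ (suc m) K N K≤N ρ ρ≤K = begin
    coeff ρ (trunc K (pleth (Ω₀UpTo K) (Ω₀iter m K)))
      ≡⟨ coeff-trunc-≤ K (pleth (Ω₀UpTo K) (Ω₀iter m K)) ρ ρ≤K ⟩
    coeff ρ (pleth (Ω₀UpTo K) (Ω₀iter m K))
      ≡⟨ pleth-cong≤ K (Positive-Σh (range1 K)) (Positive-Σh (range1 N)) (Positive-Ω₀iter m K) (Positive-Ω₀iter m N)
           (MinDegree-Ω₀iter m K) (MinDegree-Ω₀iter m N) (Ω₀UpTo-cong≤ K N K≤N) (Ω₀iter-cong≤ m K N K≤N) ρ ρ≤K ⟩
    coeff ρ (pleth (Ω₀UpTo N) (Ω₀iter m N))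
      ≡⟨ coeff-trunc-≤ N (pleth (Ω₀UpTo N) (Ω₀iter m N)) ρ (ℕP.≤-trans ρ≤K K≤N) ⟨
    coeff ρ (trunc N (pleth (Ω₀UpTo N) (Ω₀iter m N))) ∎

  B-cong≤ : ∀ m K N → K ≤ N → B m K ≈[≤ K ] B m N
  B-cong≤ m K N K≤N = pleth-cong≤ K (Positive-ΩUpTo K) (Positive-ΩUpTo N) (Positive-Ω₀iter m K) (Positive-Ω₀iter m N)
    (MinDegree-Ω₀iter m K) (MinDegree-Ω₀iter m N) (ΩUpTo-cong≤ K N K≤N) (Ω₀iter-cong≤ m K N K≤N)

module InnerSum where

  open Casts
  open FiniteSums
  open Intervals
  open Coefficients
  open SeriesInvariants
  open CoefficientAlgebra
  open ExponentialFormula using (logΩ; MinDegree-logΩ)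
  open DegreeTruncation using (coeff-trunc-≤; B-cong≤; sum-map-/≤)
  open CentralizerOrder using (z-map-*; z-positive)
  open import Data.Nat.Divisibility using (_∣_; _∣?_; ∣⇒≤; ∣-trans; 0∣⇒≡0; _∣0)
  open import Data.Nat.DivMod using (m*[n/m]≡n)
  open import Data.Nat.GCD using (gcd[m,n]∣m; gcd[m,n]∣n; gcd-greatest)

  gcdL-∣ : ∀ μ → All (gcdL μ ∣_) μ
  gcdL-∣ [] = []
  gcdL-∣ (x ∷ μ) = gcd[m,n]∣m x (gcdL μ) ∷ All.map (∣-trans (gcd[m,n]∣n x (gcdL μ))) (gcdL-∣ μ)

  gcdL-greatest : ∀ {d} μ → All (d ∣_) μ → d ∣ gcdL μ
  gcdL-greatest [] [] = _ ∣0
  gcdL-greatest (x ∷ μ) (d∣x ∷ d∣μ) = gcd-greatest d∣x (gcdL-greatest μ d∣μ)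

  gcdL-positive : ∀ x μ → All (0 <_) (x ∷ μ) → 0 < gcdL (x ∷ μ)
  gcdL-positive x μ (x>0 ∷ _) with gcdL (x ∷ μ) | gcdL-∣ (x ∷ μ)
  ... | zero | 0∣x ∷ _ = ⊥-elim (ℕP.<-irrefl (sym (0∣⇒≡0 0∣x)) x>0)
  ... | suc _ | _ = s≤s z≤n

  gcdL≤sum : ∀ x μ → All (0 <_) (x ∷ μ) → gcdL (x ∷ μ) ≤ sum (x ∷ μ)
  gcdL≤sum x μ (x>0 ∷ _) = ℕP.≤-trans (∣⇒≤ {{ℕ.>-nonZero x>0}} (All.head (gcdL-∣ (x ∷ μ)))) (ℕP.m≤m+n x (sum μ))

  𝟙-∣gcdL : ∀ d μ → 𝟙 (d ∣? gcdL μ) ≡ 𝟙 (all? (d ∣?_) μ)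
  𝟙-∣gcdL d μ = 𝟙-⇔ (d ∣? gcdL μ) (all? (d ∣?_) μ) (λ d∣g → All.map (∣-trans d∣g) (gcdL-∣ μ)) (gcdL-greatest μ)

  divP-positive : ∀ k-1 μ → All (suc k-1 ∣_) μ → All (0 <_) μ → All (0 <_) (divP μ (suc k-1))
  divP-positive k-1 [] [] [] = []
  divP-positive k-1 (x ∷ μ) (k∣x ∷ k∣μ) (x>0 ∷ pos) = quotient>0 ∷ divP-positive k-1 μ k∣μ pos
    where
    quotient>0 : 0 < x ℕ./ suc k-1
    quotient>0 with x ℕ./ suc k-1 | m*[n/m]≡n k∣x
    ... | zero | k*0≡x = ⊥-elim (ℕP.<-irrefl (trans (sym (ℕP.*-zeroʳ (suc k-1))) k*0≡x) x>0)
    ... | suc _ | _ = s≤s z≤n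

  -- The degree-0 term h₀ of Ω contributes only to p_∅, so Ω₀(G) and Ω(G) agree at ν ≠ ∅.
  coeff-Ω₀iter-suc : ∀ m N ν → All (0 <_) ν → ν ≢ [] → sum ν ≤ N → coeff ν (Ω₀iter (suc m) N) ≡ inv (z ν) * β m ν
  coeff-Ω₀iter-suc m N ν pos ν≢[] ν≤N = begin
    coeff ν (trunc N (pleth (Ω₀UpTo N) G))
      ≡⟨ coeff-trunc-≤ N (pleth (Ω₀UpTo N) G) ν ν≤N ⟩
    coeff ν (pleth (Ω₀UpTo N) G)
      ≡⟨ coeff-pleth-concatMap ν h (range1 N) G ⟩
    Σ (range1 N) (λ k → coeff ν (pleth (h k) G))
      ≡⟨ ℚP.+-identityˡ _ ⟨
    0ℚ + Σ (range1 N) (λ k → coeff ν (pleth (h k) G))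
      ≡⟨ cong (_+ Σ (range1 N) (λ k → coeff ν (pleth (h k) G))) h₀-term ⟨
    Σ (0 ∷ range1 N) (λ k → coeff ν (pleth (h k) G))
      ≡⟨ cong (λ l → Σ l (λ k → coeff ν (pleth (h k) G))) (upTo-suc N) ⟨
    Σ (upTo (suc N)) (λ k → coeff ν (pleth (h k) G))
      ≡⟨ coeff-pleth-concatMap ν h (upTo (suc N)) G ⟨
    coeff ν (B m N)
      ≡⟨ B-cong≤ m (sum ν) N ν≤N ν ℕP.≤-refl ⟨
    coeff ν (B m (sum ν))
      ≡⟨ ℚP.*-identityˡ _ ⟨
    1ℚ * coeff ν (B m (sum ν))
      ≡⟨ cong (_* coeff ν (B m (sum ν))) (inv*ℕtoℚ≡1 (z-positive ν pos)) ⟨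
    (inv (z ν) * ℕtoℚ (z ν)) * coeff ν (B m (sum ν))
      ≡⟨ ℚP.*-assoc (inv (z ν)) _ _ ⟩
    inv (z ν) * β m ν ∎
    where
    G = Ω₀iter m N
    h₀-term : coeff ν (pleth (h 0) G) ≡ 0ℚ
    h₀-term = trans (coeff-pleth-terms ν (h 0) G)
      (trans (ℚP.+-identityʳ _) (trans (cong (inv (z []) *_) (coeff-oneS ν ν≢[])) (ℚP.*-zeroʳ (inv (z [])))))

  coeff-pleth-logΩ : ∀ N A μ → coeff μ (pleth (logΩ N) A) ≡
                     Σ (upTo N) (λ k → inv (suc k) * (𝟙 (all? (suc k ∣?_) μ) * coeff (divP μ (suc k)) A))
  coeff-pleth-logΩ N A μ = begin
    coeff μ (pleth (logΩ N) A)
      ≡⟨ coeff-pleth-terms μ (logΩ N) A ⟩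
    Σ (logΩ N) (λ t → proj₂ t * coeff μ (pν (proj₁ t) A))
      ≡⟨ Σ-map (λ k → [ k ] , inv k) (range1 N) _ ⟩
    Σ (range1 N) (λ k → inv k * coeff μ (pk k A ⊗ oneS))
      ≡⟨ Σ-map suc (upTo N) _ ⟩
    Σ (upTo N) (λ k → inv (suc k) * coeff μ (pk (suc k) A ⊗ oneS))
      ≡⟨ Σ-cong (upTo N) (λ k → cong (inv (suc k) *_) (trans (⊗-oneS (pk (suc k) A) μ) (coeff-pk k μ A))) ⟩
    Σ (upTo N) (λ k → inv (suc k) * (𝟙 (all? (suc k ∣?_) μ) * coeff (divP μ (suc k)) A)) ∎

  -- z_μ = d^{ℓ(μ)} z_{μ/d} and [p_{μ/d}] Ω₀^{(m+1)} = β^{(m)}(μ/d)/z_{μ/d}.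
  divisor-term : ∀ m N k-1 x μ → All (0 <_) (x ∷ μ) → sum (x ∷ μ) ≤ N → All (suc k-1 ∣_) (x ∷ μ) →
    ℕtoℚ (z (x ∷ μ)) * (inv (suc k-1) * coeff (divP (x ∷ μ) (suc k-1)) (Ω₀iter (suc m) N)) ≡
    ℕtoℚ (suc k-1 ^ length μ) * β m (divP (x ∷ μ) (suc k-1))
  divisor-term m N k-1 x μ pos ≤N d∣ = begin
    ℕtoℚ (z (x ∷ μ)) * (inv d * coeff ν (Ω₀iter (suc m) N))
      ≡⟨ cong₂ (λ u w → ℕtoℚ u * (inv d * w)) z-split (coeff-Ω₀iter-suc m N ν ν-pos (λ ()) (ℕP.≤-trans (sum-map-/≤ k-1 (x ∷ μ)) ≤N)) ⟩
    ℕtoℚ (d ℕ.* (d ^ length μ ℕ.* z ν)) * (inv d * (inv (z ν) * β m ν))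
      ≡⟨ cong (_* (inv d * (inv (z ν) * β m ν))) (trans (ℕtoℚ-* d (d ^ length μ ℕ.* z ν)) (cong (ℕtoℚ d *_) (ℕtoℚ-* (d ^ length μ) (z ν)))) ⟩
    (ℕtoℚ d * (ℕtoℚ (d ^ length μ) * ℕtoℚ (z ν))) * (inv d * (inv (z ν) * β m ν))
      ≡⟨ rearrange (ℕtoℚ d) (ℕtoℚ (d ^ length μ)) (ℕtoℚ (z ν)) (inv d) (inv (z ν)) (β m ν) ⟩
    (ℕtoℚ (d ^ length μ) * β m ν) * ((inv d * ℕtoℚ d) * (inv (z ν) * ℕtoℚ (z ν)))
      ≡⟨ cong₂ (λ u w → (ℕtoℚ (d ^ length μ) * β m ν) * (u * w)) (inv*ℕtoℚ≡1 {d} (s≤s z≤n)) (inv*ℕtoℚ≡1 (z-positive ν ν-pos)) ⟩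
    (ℕtoℚ (d ^ length μ) * β m ν) * (1ℚ * 1ℚ)
      ≡⟨ ℚP.*-identityʳ _ ⟩
    ℕtoℚ (d ^ length μ) * β m ν ∎
    where
    d = suc k-1
    ν = divP (x ∷ μ) d
    ν-pos : All (0 <_) ν
    ν-pos = divP-positive k-1 (x ∷ μ) d∣ pos
    z-split : z (x ∷ μ) ≡ d ℕ.* (d ^ length μ ℕ.* z ν)
    z-split = begin
      z (x ∷ μ)                  ≡⟨ cong z (mul-div k-1 (x ∷ μ) d∣) ⟨
      z (map (d ℕ.*_) ν)         ≡⟨ z-map-* k-1 ν ν-pos ⟩
      d ^ length ν ℕ.* z ν       ≡⟨ cong (λ l → d ^ l ℕ.* z ν) (ListP.length-map (ℕ._/ d) (x ∷ μ)) ⟩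
      d ^ suc (length μ) ℕ.* z ν ≡⟨ ℕP.*-assoc d (d ^ length μ) (z ν) ⟩
      d ℕ.* (d ^ length μ ℕ.* z ν) ∎
    rearrange : ∀ D P Z iD iZ b → (D * (P * Z)) * (iD * (iZ * b)) ≡ (P * b) * ((iD * D) * (iZ * Z))
    rearrange = solve 6 (λ D P Z iD iZ b → (D ⊗ₑ (P ⊗ₑ Z)) ⊗ₑ (iD ⊗ₑ (iZ ⊗ₑ b)) ⊜ (P ⊗ₑ b) ⊗ₑ ((iD ⊗ₑ D) ⊗ₑ (iZ ⊗ₑ Z))) refl
      where open ℚ-Solver

  innerSum≡z*coeff : ∀ m N μ → IsPartition μ → sum μ ≤ N →
                     innerSum m μ ≡ ℕtoℚ (z μ) * coeff μ (pleth (logΩ N) (Ω₀iter (suc m) N))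
  innerSum≡z*coeff m N [] _ _ = sym (trans (cong (1ℚ *_)
    (coeff-below-MinDegree 1 _ [] (MinDegree-pleth 1 (logΩ N) _ (MinDegree-logΩ N) (MinDegree-Ω₀iter (suc m) N)) (s≤s z≤n))) (ℚP.*-zeroʳ 1ℚ))
  innerSum≡z*coeff m N μ@(x ∷ μ') (pos , _) μ≤N = begin
    innerSum m μ
      ≡⟨ Σ-cong (upTo g) (λ k → trans (if-then-0≡𝟙* (suc k ∣? g) (term k)) (cong (_* term k) (𝟙-∣gcdL (suc k) μ))) ⟩
    Σ (upTo g) (λ k → 𝟙 (all? (suc k ∣?_) μ) * term k)
      ≡⟨ Σ-upTo-extend g N _ g≤N (λ k g≤k → 𝟙-no-* (all? (suc k ∣?_) μ)
           (λ k+1∣μ → ℕP.<-irrefl refl (ℕP.≤-<-trans g≤k (∣⇒≤ {{ℕ.>-nonZero g>0}} (gcdL-greatest μ k+1∣μ))))) ⟩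
    Σ (upTo N) (λ k → 𝟙 (all? (suc k ∣?_) μ) * term k)
      ≡⟨ Σ-cong (upTo N) per-divisor ⟩
    Σ (upTo N) (λ k → ℕtoℚ (z μ) * (inv (suc k) * (𝟙 (all? (suc k ∣?_) μ) * coeff (divP μ (suc k)) F)))
      ≡⟨ *-distribˡ-Σ (ℕtoℚ (z μ)) (upTo N) _ ⟨
    ℕtoℚ (z μ) * Σ (upTo N) (λ k → inv (suc k) * (𝟙 (all? (suc k ∣?_) μ) * coeff (divP μ (suc k)) F))
      ≡⟨ cong (ℕtoℚ (z μ) *_) (coeff-pleth-logΩ N F μ) ⟨
    ℕtoℚ (z μ) * coeff μ (pleth (logΩ N) F) ∎
    where
    F = Ω₀iter (suc m) N
    g = gcdL μ
    g>0 : 0 < g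
    g>0 = gcdL-positive x μ' pos
    g≤N : g ≤ N
    g≤N = ℕP.≤-trans (gcdL≤sum x μ' pos) μ≤N
    term : ℕ → ℚ
    term k = ℕtoℚ (suc k ^ (length μ ∸ 1)) * β m (divP μ (suc k))
    per-divisor : ∀ k → 𝟙 (all? (suc k ∣?_) μ) * term k ≡
                        ℕtoℚ (z μ) * (inv (suc k) * (𝟙 (all? (suc k ∣?_) μ) * coeff (divP μ (suc k)) F))
    per-divisor k = begin
      𝟙 D * term k
        ≡⟨ 𝟙-guard D (λ k+1∣μ → sym (divisor-term m N k x μ' pos μ≤N k+1∣μ)) ⟩
      𝟙 D * (Z * (inv (suc k) * c))
        ≡⟨ ℚ*.x∙yz≈y∙xz (𝟙 D) Z (inv (suc k) * c) ⟩
      Z * (𝟙 D * (inv (suc k) * c))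
        ≡⟨ cong (Z *_) (ℚ*.x∙yz≈y∙xz (𝟙 D) (inv (suc k)) c) ⟩
      Z * (inv (suc k) * (𝟙 D * c)) ∎
      where
      D = all? (suc k ∣?_) μ
      Z = ℕtoℚ (z μ)
      c = coeff (divP μ (suc k)) F

module Multinomial where

  open Casts
  open Intervals using (range1≡interval)
  open CentralizerOrder

  prodℚ-distrib-* : {A : Set} (xs : List A) (f g : A → ℚ) → prodℚ (map (λ x → f x * g x) xs) ≡ prodℚ (map f xs) * prodℚ (map g xs)
  prodℚ-distrib-* [] f g = sym (ℚP.*-identityˡ 1ℚ)
  prodℚ-distrib-* (x ∷ xs) f g = trans (cong (f x * g x *_) (prodℚ-distrib-* xs f g)) (ℚ*.interchange (f x) (g x) _ _)

  prodℚ-cong-All : {A : Set} {xs : List A} {f g : A → ℚ} → All (λ x → f x ≡ g x) xs → prodℚ (map f xs) ≡ prodℚ (map g xs)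
  prodℚ-cong-All [] = refl
  prodℚ-cong-All (e ∷ es) = cong₂ _*_ e (prodℚ-cong-All es)

  product-concat : ∀ μs → product (concat μs) ≡ Π μs product
  product-concat [] = refl
  product-concat (μ ∷ μs) = trans (product-++ μ (concat μs)) (cong (product μ ℕ.*_) (product-concat μs))

  multinom≡ : ∀ la μs → All (0 <_) la → concat μs ↭ la → multinom la μs ≡ ℕtoℚ (multFactorials la) * inv (Π μs multFactorials)
  multinom≡ la μs pos μs↭la = begin
    multinom la μs
      ≡⟨ prodℚ-distrib-* S (λ j → ℕtoℚ (mult j la !)) (λ j → inv (Π μs (λ μ → mult j μ !))) ⟩
    prodℚ (map (λ j → ℕtoℚ (mult j la !)) S) * prodℚ (map (λ j → inv (Π μs (λ μ → mult j μ !))) S)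
      ≡⟨ cong₂ _*_ (ℕtoℚ-product (λ j → mult j la !) S) (inv-product (λ j → Π μs (λ μ → mult j μ !)) S) ⟩
    ℕtoℚ (Π S (λ j → mult j la !)) * inv (Π S (λ j → Π μs (λ μ → mult j μ !)))
      ≡⟨ cong₂ (λ u v → ℕtoℚ u * inv v) (multFactorials-in-range la la-in) (trans (Π-comm S μs (λ j μ → mult j μ !))
           (Π-cong-All (All.map (λ {μ} μ-in → multFactorials-in-range μ μ-in) μs-in))) ⟩
    ℕtoℚ (multFactorials la) * inv (Π μs multFactorials) ∎
    where
    S = range1 (sum la)
    la-in : PartsIn (sum la) la
    la-in = partsIn-sum la pos
    μs-in : All (PartsIn (sum la)) μs
    μs-in = AllP.concat⁻ (↭P.All-resp-↭ (↭-sym μs↭la) la-in)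
    multFactorials-in-range : ∀ ν → PartsIn (sum la) ν → Π S (λ j → mult j ν !) ≡ multFactorials ν
    multFactorials-in-range ν ν-in = trans (cong (λ l → Π l (λ j → mult j ν !)) (range1≡interval (sum la))) (Π-mult!≡multFactorials (sum la) ν ν-in)

  -- z = ∏ⱼ mⱼ! · ∏ parts, and the product of the parts is multiplicative under concatenation.
  multinom*Πz : ∀ la μs → All (0 <_) la → All (All (0 <_)) μs → concat μs ↭ la → (g : List ℕ → ℚ) →
                multinom la μs * prodℚ (map (λ μ → ℕtoℚ (z μ) * g μ) μs) ≡ ℕtoℚ (z la) * prodℚ (map g μs)
  multinom*Πz la μs pos μs-pos μs↭la g = begin
    multinom la μs * prodℚ (map (λ μ → ℕtoℚ (z μ) * g μ) μs)
      ≡⟨ cong₂ _*_ (multinom≡ la μs pos μs↭la) (trans (prodℚ-distrib-* μs (ℕtoℚ ∘ z) g) (cong (_* Πg) (ℕtoℚ-product z μs))) ⟩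
    (ℕtoℚ (multFactorials la) * inv M) * (ℕtoℚ (Π μs z) * Πg)
      ≡⟨ cong (λ u → (ℕtoℚ (multFactorials la) * inv M) * (u * Πg)) (trans (cong ℕtoℚ Πz≡M*product) (ℕtoℚ-* M (product la))) ⟩
    (ℕtoℚ (multFactorials la) * inv M) * ((ℕtoℚ M * ℕtoℚ (product la)) * Πg)
      ≡⟨ rearrange (ℕtoℚ (multFactorials la)) (inv M) (ℕtoℚ M) (ℕtoℚ (product la)) Πg ⟩
    ((ℕtoℚ (multFactorials la) * ℕtoℚ (product la)) * Πg) * (inv M * ℕtoℚ M)
      ≡⟨ cong₂ _*_ (cong (_* Πg) (trans (sym (ℕtoℚ-* (multFactorials la) (product la))) (cong ℕtoℚ (sym (z≡multFactorials*product la pos)))))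
                   (inv*ℕtoℚ≡1 (Π-positive μs multFactorials multFactorials-positive)) ⟩
    (ℕtoℚ (z la) * Πg) * 1ℚ
      ≡⟨ ℚP.*-identityʳ _ ⟩
    ℕtoℚ (z la) * Πg ∎
    where
    M = Π μs multFactorials
    Πg = prodℚ (map g μs)
    Πz≡M*product : Π μs z ≡ M ℕ.* product la
    Πz≡M*product = begin
      Π μs z                                            ≡⟨ Π-cong-All (All.map (λ {μ} μ-pos → z≡multFactorials*product μ μ-pos) μs-pos) ⟩
      Π μs (λ μ → multFactorials μ ℕ.* product μ)       ≡⟨ Π-distrib-* μs multFactorials product ⟩
      M ℕ.* Π μs product                                ≡⟨ cong (M ℕ.*_) (trans (sym (product-concat μs)) (product-↭ μs↭la)) ⟩
      M ℕ.* product la                                  ∎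
    rearrange : ∀ a i b p q → (a * i) * ((b * p) * q) ≡ ((a * p) * q) * (i * b)
    rearrange = solve 5 (λ a i b p q → (a ⊗ₑ i) ⊗ₑ ((b ⊗ₑ p) ⊗ₑ q) ⊜ ((a ⊗ₑ p) ⊗ₑ q) ⊗ₑ (i ⊗ₑ b)) refl
      where open ℚ-Solver

module CoverSums where

  open FiniteSums
  open Multisets using (≈ₘ⇒↭)
  open Coefficients using (Positive; MinDegree)
  open SeriesInvariants
  open ExponentialFormula using (logΩ; Positive-logΩ; MinDegree-logΩ)
  open Tuples
  open InnerSum using (innerSum≡z*coeff)
  open Multinomial using (prodℚ-cong-All; multinom*Πz)

  logΩ∘Ω₀iter : ℕ → ℕ → Sym
  logΩ∘Ω₀iter m N = pleth (logΩ N) (Ω₀iter (suc m) N)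

  sum≤sum-concat : ∀ μs → All (λ μ → sum μ ≤ sum (concat μs)) μs
  sum≤sum-concat [] = []
  sum≤sum-concat (μ ∷ μs) = subst (sum μ ≤_) (sym (sum-++ μ (concat μs))) (ℕP.m≤m+n (sum μ) (sum (concat μs)))
    ∷ All.map (λ μ'≤ → ℕP.≤-trans μ'≤ (subst (sum (concat μs) ≤_) (sym (sum-++ μ (concat μs))) (ℕP.m≤n+m _ (sum μ)))) (sum≤sum-concat μs)

  cover-summand : ∀ m la → All (0 <_) la → ∀ μs → All IsPartition μs → sum (concat μs) ≡ sum la →
            𝟙 (concat μs ≈ₘ? la) * (multinom la μs * prodℚ (map (innerSum m) μs)) ≡
            ℕtoℚ (z la) * (𝟙 (concat μs ≈ₘ? la) * Πc (λ μ → coeff μ (logΩ∘Ω₀iter m (sum la))) μs)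
  cover-summand m la pos μs μs-part μs-sum = begin
    𝟙 (concat μs ≈ₘ? la) * (multinom la μs * prodℚ (map (innerSum m) μs))
      ≡⟨ cong (λ u → 𝟙 (concat μs ≈ₘ? la) * (multinom la μs * u)) (prodℚ-cong-All (All.zipWith (λ { {μ} (μ-part , μ≤) →
           innerSum≡z*coeff m (sum la) μ μ-part (subst (sum μ ≤_) μs-sum μ≤) }) (μs-part , sum≤sum-concat μs))) ⟩
    𝟙 (concat μs ≈ₘ? la) * (multinom la μs * prodℚ (map (λ μ → ℕtoℚ (z μ) * coeff μ L) μs))
      ≡⟨ 𝟙-guard (concat μs ≈ₘ? la) (λ e → multinom*Πz la μs pos (All.map proj₁ μs-part) (≈ₘ⇒↭ {concat μs} {la} e) (λ μ → coeff μ L)) ⟩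
    𝟙 (concat μs ≈ₘ? la) * (ℕtoℚ (z la) * Πc (λ μ → coeff μ L) μs)
      ≡⟨ ℚ*.x∙yz≈y∙xz (𝟙 (concat μs ≈ₘ? la)) (ℕtoℚ (z la)) _ ⟩
    ℕtoℚ (z la) * (𝟙 (concat μs ≈ₘ? la) * Πc (λ μ → coeff μ L) μs) ∎
    where
    L = logΩ∘Ω₀iter m (sum la)

  z*coeff-power : ∀ m la → All (0 <_) la → ∀ n →
                  ℕtoℚ (z la) * coeff la (prodS (replicate n (logΩ∘Ω₀iter m (sum la)))) ≡
                  Σ (covers n la) (λ μs → multinom la μs * prodℚ (map (innerSum m) μs))
  z*coeff-power m la pos n = begin
    ℕtoℚ (z la) * coeff la (prodS (replicate n L))
      ≡⟨ cong (ℕtoℚ (z la) *_) (coeff-power L L-pos L≥1 n la pos) ⟩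
    ℕtoℚ (z la) * Σ (tuples n N) (λ μs → 𝟙 (concat μs ≈ₘ? la) * Πc (λ μ → coeff μ L) μs)
      ≡⟨ *-distribˡ-Σ (ℕtoℚ (z la)) (tuples n N) _ ⟩
    Σ (tuples n N) (λ μs → ℕtoℚ (z la) * (𝟙 (concat μs ≈ₘ? la) * Πc (λ μ → coeff μ L) μs))
      ≡⟨ Σ-cong-All (All.map (λ { {μs} (μs-part , μs-sum) → cover-summand m la pos μs μs-part μs-sum }) (tuples-valid n N)) ⟨
    Σ (tuples n N) (λ μs → 𝟙 (concat μs ≈ₘ? la) * (multinom la μs * prodℚ (map (innerSum m) μs)))
      ≡⟨ Σ-filter (λ μs → concat μs ≈ₘ? la) (tuples n N) _ ⟨
    Σ (covers n la) (λ μs → multinom la μs * prodℚ (map (innerSum m) μs)) ∎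
    where
    N = sum la
    L = logΩ∘Ω₀iter m N
    L-pos : Positive L
    L-pos = Positive-pleth (logΩ N) _ (Positive-logΩ N) (Positive-Ω₀iter (suc m) N)
    L≥1 : MinDegree 1 L
    L≥1 = MinDegree-pleth 1 (logΩ N) _ (MinDegree-logΩ N) (MinDegree-Ω₀iter (suc m) N)

open FiniteSums using (Σ; *-distribˡ-Σ; Σ-cong)
open ExponentialFormula using (coeff-Ω-pleth)
open SeriesInvariants using (Positive-Ω₀iter; MinDegree-Ω₀iter)
open CoverSums using (logΩ∘Ω₀iter; z*coeff-power)

mainTheorem6 : (m : ℕ) (la : List ℕ) → IsPartition la → la ≢ [] →
    β (suc m) la ≡
      sumℚ (map (λ n → inv (n !) *
                   sumℚ (map (λ μs → multinom la μs * prodℚ (map (innerSum m) μs))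
                             (covers n la)))
                (range1 (sum la)))
mainTheorem6 m la (pos , _) la≢[] = begin
  ℕtoℚ (z la) * coeff la (pleth (ΩUpTo N) (Ω₀iter (suc m) N))
    ≡⟨ cong (ℕtoℚ (z la) *_) (coeff-Ω-pleth la pos la≢[] (Ω₀iter (suc m) N) (Positive-Ω₀iter (suc m) N) (MinDegree-Ω₀iter (suc m) N)) ⟩
  ℕtoℚ (z la) * Σ (range1 N) (λ n → inv (n !) * coeff la (Lⁿ n))
    ≡⟨ *-distribˡ-Σ (ℕtoℚ (z la)) (range1 N) _ ⟩
  Σ (range1 N) (λ n → ℕtoℚ (z la) * (inv (n !) * coeff la (Lⁿ n)))
    ≡⟨ Σ-cong (range1 N) (λ n → trans (ℚ*.x∙yz≈y∙xz (ℕtoℚ (z la)) (inv (n !)) _) (cong (inv (n !) *_) (z*coeff-power m la pos n))) ⟩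
  Σ (range1 N) (λ n → inv (n !) * Σ (covers n la) (λ μs → multinom la μs * prodℚ (map (innerSum m) μs))) ∎
  where
  N = sum la
  Lⁿ : ℕ → Sym
  Lⁿ n = prodS (replicate n (logΩ∘Ω₀iter m N))
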